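{- Let $V$ be a vector configuration and $W\subseteq V$ a subconfiguration with $\operatorname{lin}(W)\cap V=W$. Then the following three equalities are equivalent: (i) $\operatorname{Disc}(V)=\operatorname{Disc}(W)+\operatorname{Disc}(V/W)$; (ii) $\deg^*(V)=\deg^*(W)+\deg^*(V/W)$; (iii) $\operatorname{codeg}^*(V)=\operatorname{codeg}^*(W)+\operatorname{codeg}^*(V/W)$.
   Context: A vector configuration is a finite family of vectors in $\mathbb{R}^r$ (repetitions and zero vectors allowed); subconfigurations are subfamilies; cardinalities count multiplicities; rank is $\dim\operatorname{lin}(\cdot)$. The condition $\operatorname{lin}(W)\cap V=W$ means every element of $V$ in $\operatorname{lin}(W)$ belongs to $W$. $V/W$ is the family of images of elements of $V\setminus W$ in $\mathbb{R}^r/\operatorname{lin}(W)$. For an oriented linear hyperplane $H$ given by a nonzero linear functional $f$, $H^+=\{f>0\}$, $H^-=\{f<0\}$, $\overline{H}^-=\{f\le0\}$. For a family $U$: $\operatorname{codeg}^*(U)=\min_H|\overline{H}^-\cap U|$, $\deg^*(U)=\max_H|H^+\cap U|-\operatorname{rank}(U)$, $\operatorname{Disc}(U)=\max_H(|H^+\cap U|-|H^-\cap U|)$, over all oriented linear hyperplanes of the ambient space. -}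

module Defs where

open import Level using (0ℓ)
open import Data.Nat as ℕ using (ℕ; zero; suc)
open import Data.Integer as ℤ using (ℤ; +_; _-_)
open import Data.Bool using (Bool; true; false; _∧_; not; if_then_else_)
open import Data.Fin using (Fin)
open import Data.Fin.Subset using (Subset; _∈_; ⊤; ∁) renaming (⊥ to ∅)
open import Data.Vec using (Vec; []; _∷_; lookup; replicate; zipWith; map; foldr)
open import Data.List using (List)
import Data.List as L
open import Data.Nat.ListAction using (sum)
open import Data.Product using (Σ; ∃; _×_; _,_)
open import Data.Sum using (_⊎_)
open import Relation.Binary.PropositionalEquality using (_≡_; _≢_)
open import Relation.Binary.Core using (Rel)
open import Relation.Binary.Definitions using (tri<; tri≈; tri>)
open import Relation.Binary.Structures using (IsStrictTotalOrder)
open import Algebra.Structures using (IsCommutativeRing)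

-- The real numbers, axiomatised as a Dedekind-complete ordered field
-- (unique up to isomorphism).  Theorems are quantified over every such
-- structure.  Order is assumed trichotomous (classically true for ℝ).

record RealField : Set₁ where
  infixl 6 _+_
  infixl 7 _*_
  infix 4 _<_ _≤_
  field
    Carrier : Set
    0# 1#   : Carrier
    _+_ _*_ : Carrier → Carrier → Carrier
    -_      : Carrier → Carrier
    _<_     : Rel Carrier 0ℓ
    isCommutativeRing   : IsCommutativeRing _≡_ _+_ _*_ -_ 0# 1#
    0≢1                 : 0# ≢ 1#
    inverse             : ∀ x → x ≢ 0# → ∃ λ y → x * y ≡ 1#
    isStrictTotalOrder  : IsStrictTotalOrder _≡_ _<_
    +-mono-<            : ∀ {x y} z → x < y → x + z < y + z
    *-pos               : ∀ {x y} → 0# < x → 0# < y → 0# < x * y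

  _≤_ : Carrier → Carrier → Set
  x ≤ y = x < y ⊎ x ≡ y

  field
    sup : (S : Carrier → Set) → ∃ S → (∃ λ b → ∀ x → S x → x ≤ b) →
          ∃ λ s → (∀ x → S x → x ≤ s) × (∀ b → (∀ x → S x → x ≤ b) → s ≤ b)

  open IsStrictTotalOrder isStrictTotalOrder public using (compare)

-- Vector configurations: V : Fin n → ℝ^r (a family, repetitions and
-- zero vectors allowed); subconfigurations are subsets of the index set.
-- Oriented linear hyperplanes are given by nonzero functionals f ∈ ℝ^r,
-- acting by the dot product.

module _ (ℝ : RealField) where
  open RealField ℝ

  dot : ∀ {r} → Vec Carrier r → Vec Carrier r → Carrier
  dot f v = foldr _ _+_ 0# (zipWith _*_ f v)

  posB : Carrier → Bool
  posB x with compare 0# x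
  ... | tri< _ _ _ = true
  ... | tri≈ _ _ _ = false
  ... | tri> _ _ _ = false

  negB : Carrier → Bool
  negB x with compare x 0#
  ... | tri< _ _ _ = true
  ... | tri≈ _ _ _ = false
  ... | tri> _ _ _ = false

  module _ {r n : ℕ} (V : Fin n → Vec Carrier r) where

    countBy : (Carrier → Bool) → Vec Carrier r → Subset n → ℕ
    countBy b f U =
      sum (L.map (λ i → if lookup U i ∧ b (dot f (V i)) then 1 else 0)
                   (L.allFin n))

    plusCount minusCount closedMinusCount : Vec Carrier r → Subset n → ℕ
    plusCount        = countBy posB
    minusCount       = countBy negB
    closedMinusCount = countBy (λ x → not (posB x))

    lincomb : ∀ {k} → Vec (Fin n) k → Vec Carrier k → Vec Carrier r
    lincomb []       []       = replicate r 0#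
    lincomb (i ∷ is) (c ∷ cs) = zipWith _+_ (map (c *_) (V i)) (lincomb is cs)

    AllIn : ∀ {k} → Subset n → Vec (Fin n) k → Set
    AllIn S idx = ∀ j → lookup idx j ∈ S

    InSpan : Subset n → Vec Carrier r → Set
    InSpan S x = Σ ℕ λ k → Σ (Vec (Fin n) k) λ idx → AllIn S idx ×
                 Σ (Vec Carrier k) λ c → x ≡ lincomb idx c

    IndepMod : Subset n → ∀ {k} → Vec (Fin n) k → Set
    IndepMod S idx = ∀ c → InSpan S (lincomb idx c) → ∀ j → lookup c j ≡ 0#

    -- rank of the image of the subfamily U in ℝ^r / lin(S)
    -- (= maximal size of a linearly independent subfamily)
    IsRankMod : Subset n → Subset n → ℕ → Set
    IsRankMod S U k =
      (Σ (Vec (Fin n) k) λ idx → AllIn U idx × IndepMod S idx) ×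
      (∀ {m} (idx : Vec (Fin n) m) → AllIn U idx → IndepMod S idx → m ℕ.≤ k)

    LinClosed : Subset n → Set
    LinClosed W = ∀ i → InSpan W (V i) → i ∈ W

    NonZeroF : Vec Carrier r → Set
    NonZeroF f = f ≢ replicate r 0#

    -- nonzero functionals on ℝ^r / lin(W) = nonzero functionals on ℝ^r
    -- vanishing on lin(W)
    QuotF : Subset n → Vec Carrier r → Set
    QuotF W f = NonZeroF f × (∀ i → i ∈ W → dot f (V i) ≡ 0#)

    IsMaxℤ : (Vec Carrier r → Set) → (Vec Carrier r → ℤ) → ℤ → Set
    IsMaxℤ A s m = (Σ (Vec Carrier r) λ f → A f × s f ≡ m) ×
                   (∀ f → A f → s f ℤ.≤ m)

    IsMinℕ : (Vec Carrier r → Set) → (Vec Carrier r → ℕ) → ℕ → Set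
    IsMinℕ A s m = (Σ (Vec Carrier r) λ f → A f × s f ≡ m) ×
                   (∀ f → A f → m ℕ.≤ s f)

    DiscG : (Vec Carrier r → Set) → Subset n → ℤ → Set
    DiscG A U d = IsMaxℤ A (λ f → + plusCount f U - + minusCount f U) d

    DegStarG : (Vec Carrier r → Set) → Subset n → Subset n → ℤ → Set
    DegStarG A S U d = Σ ℕ λ k → Σ ℤ λ m →
      IsRankMod S U k × IsMaxℤ A (λ f → + plusCount f U) m × d ≡ m - + k

    CodegG : (Vec Carrier r → Set) → Subset n → ℕ → Set
    CodegG A U c = IsMinℕ A (λ f → closedMinusCount f U) c

    IsDisc : Subset n → ℤ → Set
    IsDisc U = DiscG NonZeroF U

    IsDegStar : Subset n → ℤ → Set
    IsDegStar U = DegStarG NonZeroF ∅ U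

    IsCodegStar : Subset n → ℕ → Set
    IsCodegStar U = CodegG NonZeroF U

    -- Invariants of V/W (images of V ∖ W in ℝ^r / lin(W))
    IsDiscQuot : Subset n → ℤ → Set
    IsDiscQuot W = DiscG (QuotF W) (∁ W)

    IsDegStarQuot : Subset n → ℤ → Set
    IsDegStarQuot W = DegStarG (QuotF W) W (∁ W)

    IsCodegStarQuot : Subset n → ℕ → Set
    IsCodegStarQuot W = CodegG (QuotF W) (∁ W)

-- Write P(U) for the largest number of elements of U strictly on the positive side of an admissible
-- hyperplane (a hyperplane of ℝʳ, or, for V/W, one containing lin W), M for the number on the negative
-- side, N = |U|, and Z for the number of elements of U lying on every admissible hyperplane.  Then
-- codeg*(U) = N - P, deg*(U) = P - rank(U) and Disc(U) = 2P - N + Z: tilting a functional f by a small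
-- multiple of an admissible g with g(v) ≠ 0 = f(v) for some v ∈ U changes no nonzero sign of f, and
-- with the better of ±g it lowers neither P nor P - M.  So both maxima are attained where only those
-- Z elements are killed, and there P + M = N - Z.  As lin W ∩ V = W, the counts N and Z and the rank
-- are additive along V = W ⊔ (V ∖ W) (with Z = 0 for V/W), so the defects of (i), (ii) and (iii) are
-- 2δ, δ and -δ for δ = P(V) - P(W) - P(V/W), and each equality holds iff δ = 0.
module Submission where

open import Defs
open import Level using (0ℓ)
open import Data.Nat as ℕ using (ℕ; zero; suc; z≤n; s≤s)
import Data.Nat.Properties as ℕP
open import Data.Integer as ℤ using (ℤ)
import Data.Integer.Properties as ℤP
open import Data.Bool using (Bool; true; false; _∧_; not; if_then_else_)
open import Data.Bool.Properties as BoolP using (∧-zeroʳ)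
open import Data.Fin using (Fin; zero; suc; punchIn)
open import Data.Fin.Subset using (Subset; _∈_; ⊤; ∁) renaming (⊥ to ∅)
open import Data.Fin.Subset.Properties using (∉⊥; ∈⊤; x∉p⇒x∈∁p; x∈∁p⇒x∉p; _∈?_)
open import Data.Vec
  using (Vec; []; _∷_; here; there; lookup; replicate; zipWith; map; head; tail; _++_; tabulate; insertAt; removeAt; splitAt)
open import Data.Vec.Properties
  using ( ≡-dec; []=⇒lookup; lookup⇒[]=; lookup-map; lookup-replicate; insertAt-punchIn; lookup∘tabulate
        ; lookup-++ˡ; lookup-++ʳ; map-++)
open import Data.Product using (Σ; ∃; _×_; _,_; proj₁; proj₂)
open import Data.Sum using (_⊎_; inj₁; inj₂)
open import Data.Empty using (⊥-elim)
open import Function using (_∘_; id)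
open import Function.Bundles using (_⇔_; mk⇔)
open import Relation.Nullary using (¬_; Dec; yes; no; does)
open import Relation.Nullary.Decidable using (_×-dec_)
open import Relation.Binary.PropositionalEquality
open import Relation.Binary.Definitions using (tri<; tri≈; tri>)
open import Relation.Binary.Structures using (IsStrictTotalOrder)
open import Algebra.Bundles using (CommutativeRing; CommutativeMonoid)
open import Data.Fin.Properties using (all?; any?; ¬∀⟶∃¬)
import Data.List as List
import Data.Nat.ListAction as ListAction
open import Data.List.Properties using (map-tabulate)

module OrderedFieldProperties (ℝ : RealField) where
  open RealField ℝ public
  open IsStrictTotalOrder isStrictTotalOrder public
    using () renaming (trans to <-trans; irrefl to <-irrefl; asym to <-asym)

  commutativeRing : CommutativeRing 0ℓ 0ℓ
  commutativeRing = record { isCommutativeRing = isCommutativeRing }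

  open CommutativeRing commutativeRing public
    using ( +-assoc; +-comm; *-assoc; *-comm; +-identityˡ; +-identityʳ
          ; *-identityˡ; *-identityʳ; -‿inverseʳ; -‿inverseˡ; zeroˡ; zeroʳ
          ; distribˡ; distribʳ; +-commutativeMonoid; +-abelianGroup; +-group; ring)
  open import Algebra.Properties.Group +-group public using (inverseʳ-unique)
  open import Algebra.Properties.Ring ring public using (-‿distribˡ-*; -‿distribʳ-*; -‿involutive)
  open import Algebra.Properties.AbelianGroup +-abelianGroup public using (⁻¹-∙-comm)
  open import Algebra.Properties.CommutativeSemigroup
    (CommutativeMonoid.commutativeSemigroup +-commutativeMonoid) public
    using (interchange; x∙yz≈y∙xz)

  infix 4 _≟_
  _≟_ : (x y : Carrier) → Dec (x ≡ y)
  x ≟ y with compare x y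
  ... | tri< _ x≢y _ = no x≢y
  ... | tri≈ _ x≡y _ = yes x≡y
  ... | tri> _ x≢y _ = no x≢y

  -x*y≡-[x*y] : ∀ x y → (- x) * y ≡ - (x * y)
  -x*y≡-[x*y] x y = sym (-‿distribˡ-* x y)

  -1*x≡-x : ∀ x → (- 1#) * x ≡ - x
  -1*x≡-x x = trans (-x*y≡-[x*y] 1# x) (cong -_ (*-identityˡ x))

  -[xy]z≡-[zy]x : ∀ x y z → (- (x * y)) * z ≡ (- (z * y)) * x
  -[xy]z≡-[zy]x x y z = begin
    (- (x * y)) * z  ≡⟨ -x*y≡-[x*y] (x * y) z ⟩
    - (x * y * z)    ≡⟨ cong -_ (trans (*-comm (x * y) z) (trans (cong (z *_) (*-comm x y)) (sym (*-assoc z y x)))) ⟩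
    - (z * y * x)    ≡⟨ sym (-x*y≡-[x*y] (z * y) x) ⟩
    (- (z * y)) * x  ∎
    where open ≡-Reasoning

  -0≡0 : - 0# ≡ 0#
  -0≡0 = sym (inverseʳ-unique 0# 0# (+-identityʳ 0#))

  Invertible : Carrier → Set
  Invertible b = Σ Carrier λ b' → b * b' ≡ 1#

  eliminate : ∀ a b ((b⁻¹ , _) : Invertible b) → a + (- (a * b⁻¹)) * b ≡ 0#
  eliminate a b (b⁻¹ , bb⁻¹≡1) = begin
    a + (- (a * b⁻¹)) * b  ≡⟨ cong (a +_) (-x*y≡-[x*y] (a * b⁻¹) b) ⟩
    a + - (a * b⁻¹ * b)    ≡⟨ cong (λ z → a + - z) (*-assoc a b⁻¹ b) ⟩
    a + - (a * (b⁻¹ * b))  ≡⟨ cong (λ z → a + - (a * z)) (trans (*-comm b⁻¹ b) bb⁻¹≡1) ⟩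
    a + - (a * 1#)         ≡⟨ cong (λ z → a + - z) (*-identityʳ a) ⟩
    a + - a                ≡⟨ -‿inverseʳ a ⟩
    0#                     ∎
    where open ≡-Reasoning

  x*y≡0⇒x≡0 : ∀ {x y} → x * y ≡ 0# → y ≢ 0# → x ≡ 0#
  x*y≡0⇒x≡0 {x} {y} xy≡0 y≢0 with inverse y y≢0
  ... | y⁻¹ , yy⁻¹≡1 = begin
    x              ≡⟨ sym (*-identityʳ x) ⟩
    x * 1#         ≡⟨ cong (x *_) (sym yy⁻¹≡1) ⟩
    x * (y * y⁻¹)  ≡⟨ sym (*-assoc x y y⁻¹) ⟩
    x * y * y⁻¹    ≡⟨ cong (_* y⁻¹) xy≡0 ⟩
    0# * y⁻¹       ≡⟨ zeroˡ y⁻¹ ⟩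
    0#             ∎
    where open ≡-Reasoning

  +-monoʳ-< : ∀ {x y} z → x < y → z + x < z + y
  +-monoʳ-< {x} {y} z x<y = subst₂ _<_ (+-comm x z) (+-comm y z) (+-mono-< z x<y)

  x<0⇒0<-x : ∀ {x} → x < 0# → 0# < - x
  x<0⇒0<-x {x} x<0 = subst₂ _<_ (-‿inverseʳ x) (+-identityˡ (- x)) (+-mono-< (- x) x<0)

  0<x⇒-x<0 : ∀ {x} → 0# < x → - x < 0#
  0<x⇒-x<0 {x} 0<x = subst₂ _<_ (+-identityˡ (- x)) (-‿inverseʳ x) (+-mono-< (- x) 0<x)

  0<-x⇒x<0 : ∀ {x} → 0# < - x → x < 0#
  0<-x⇒x<0 {x} 0<-x = subst₂ _<_ (+-identityˡ x) (-‿inverseˡ x) (+-mono-< x 0<-x)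

  x<y⇒0<y-x : ∀ {x y} → x < y → 0# < y + - x
  x<y⇒0<y-x {x} x<y = subst (_< _) (-‿inverseʳ x) (+-mono-< (- x) x<y)

  0<y-x⇒x<y : ∀ {x y} → 0# < y + - x → x < y
  0<y-x⇒x<y {x} {y} 0<y-x = subst₂ _<_ (+-identityˡ x) y-x+x≡y (+-mono-< x 0<y-x)
    where
    y-x+x≡y : y + - x + x ≡ y
    y-x+x≡y = trans (+-assoc y (- x) x) (trans (cong (y +_) (-‿inverseˡ x)) (+-identityʳ y))

  0<x⇒x≢0 : ∀ {x} → 0# < x → x ≢ 0#
  0<x⇒x≢0 0<x x≡0 = <-irrefl (sym x≡0) 0<x

  0<1 : 0# < 1#
  0<1 with compare 0# 1#
  ... | tri< 0<1 _ _ = 0<1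
  ... | tri≈ _ 0≡1 _ = ⊥-elim (0≢1 0≡1)
  ... | tri> _ _ 1<0 = ⊥-elim (<-asym 1<0 (subst (0# <_) -1*-1≡1 (*-pos 0<-1 0<-1)))
    where
    0<-1 = x<0⇒0<-x 1<0
    -1*-1≡1 : (- 1#) * (- 1#) ≡ 1#
    -1*-1≡1 = trans (-x*y≡-[x*y] 1# (- 1#)) (trans (cong -_ (*-identityˡ (- 1#))) (-‿involutive 1#))

  *-pos-neg : ∀ {x y} → 0# < x → y < 0# → x * y < 0#
  *-pos-neg {x} {y} 0<x y<0 =
    0<-x⇒x<0 (subst (0# <_) (sym (-‿distribʳ-* x y)) (*-pos 0<x (x<0⇒0<-x y<0)))

  inverse-pos : ∀ {x} → 0# < x → ((x⁻¹ , _) : Invertible x) → 0# < x⁻¹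
  inverse-pos {x} 0<x (x⁻¹ , xx⁻¹≡1) with compare 0# x⁻¹
  ... | tri< 0<x⁻¹ _ _ = 0<x⁻¹
  ... | tri≈ _ 0≡x⁻¹ _ = ⊥-elim (0≢1 (trans (sym (zeroʳ x)) (trans (cong (x *_) 0≡x⁻¹) xx⁻¹≡1)))
  ... | tri> _ _ x⁻¹<0 = ⊥-elim (<-asym 0<1 (subst (_< 0#) xx⁻¹≡1 (*-pos-neg 0<x x⁻¹<0)))

  *-monoˡ-<-pos : ∀ {a x y} → 0# < a → x < y → a * x < a * y
  *-monoˡ-<-pos {a} {x} {y} 0<a x<y = 0<y-x⇒x<y (subst (0# <_) a[y-x]≡ay-ax (*-pos 0<a (x<y⇒0<y-x x<y)))
    where
    a[y-x]≡ay-ax : a * (y + - x) ≡ a * y + - (a * x)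
    a[y-x]≡ay-ax = trans (distribˡ a y (- x)) (cong (a * y +_) (sym (-‿distribʳ-* a x)))

  ≤-trans : ∀ {x y z} → x ≤ y → y ≤ z → x ≤ z
  ≤-trans (inj₁ x<y) (inj₁ y<z) = inj₁ (<-trans x<y y<z)
  ≤-trans (inj₁ x<y) (inj₂ refl) = inj₁ x<y
  ≤-trans (inj₂ refl) y≤z = y≤z

  <-≤-trans : ∀ {x y z} → x < y → y ≤ z → x < z
  <-≤-trans x<y (inj₁ y<z) = <-trans x<y y<z
  <-≤-trans x<y (inj₂ refl) = x<y

module SmallPerturbations (ℝ : RealField) where
  open OrderedFieldProperties ℝ

  KeepsSign : Carrier → Carrier → Carrier → Set
  KeepsSign x y ε = (0# < x → 0# < x + ε * y) × (x < 0# → x + ε * y < 0#)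

  ForSmall : (Carrier → Set) → Set
  ForSmall P = Σ Carrier λ δ → 0# < δ × (∀ ε → 0# < ε → ε ≤ δ → P ε)

  -- For y < 0 the threshold is δ = x / (x - y).
  forSmall-pos : ∀ {x} y → 0# < x → ForSmall (λ ε → 0# < x + ε * y)
  forSmall-pos {x} y 0<x with compare 0# y
  ... | tri< 0<y _ _ = 1# , 0<1 , λ ε 0<ε _ →
    <-trans 0<x (subst (_< x + ε * y) (+-identityʳ x) (+-monoʳ-< x (*-pos 0<ε 0<y)))
  ... | tri≈ _ 0≡y _ = 1# , 0<1 , λ ε _ _ →
    subst (0# <_) (sym (trans (cong (λ z → x + ε * z) (sym 0≡y))
                              (trans (cong (x +_) (zeroʳ ε)) (+-identityʳ x)))) 0<x
  ... | tri> _ _ y<0 = δ , *-pos 0<x (inverse-pos 0<s s⁻¹) , pos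
    where
    c = - y
    0<c = x<0⇒0<-x y<0
    s = x + c
    0<s : 0# < s
    0<s = <-trans 0<x (subst (_< s) (+-identityʳ x) (+-monoʳ-< x 0<c))
    s⁻¹ = inverse s (0<x⇒x≢0 0<s)
    δ = x * proj₁ s⁻¹
    δs≡x : δ * s ≡ x
    δs≡x = trans (*-assoc x _ s) (trans (cong (x *_) (trans (*-comm _ s) (proj₂ s⁻¹))) (*-identityʳ x))
    pos : ∀ ε → 0# < ε → ε ≤ δ → 0# < x + ε * y
    pos ε 0<ε ε≤δ = subst (0# <_) x-εc≡x+εy (x<y⇒0<y-x εc<x)
      where
      εc<εs : ε * c < ε * s
      εc<εs = subst₂ _<_ (+-identityˡ (ε * c)) (sym (distribˡ ε x c)) (+-mono-< (ε * c) (*-pos 0<ε 0<x))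
      εs≤x : ε ≤ δ → ε * s ≤ x
      εs≤x (inj₁ ε<δ) = inj₁ (subst₂ _<_ (*-comm s ε) (trans (*-comm s δ) δs≡x) (*-monoˡ-<-pos 0<s ε<δ))
      εs≤x (inj₂ refl) = inj₂ δs≡x
      εc<x = <-≤-trans εc<εs (εs≤x ε≤δ)
      x-εc≡x+εy : x + - (ε * c) ≡ x + ε * y
      x-εc≡x+εy = cong (x +_) (trans (-‿distribʳ-* ε c) (cong (ε *_) (-‿involutive y)))

  forSmall-keepsSign : ∀ x y → ForSmall (KeepsSign x y)
  forSmall-keepsSign x y with compare 0# x
  ... | tri< 0<x _ _ with forSmall-pos y 0<x
  ...   | δ , 0<δ , pos = δ , 0<δ , λ ε 0<ε ε≤δ → (λ _ → pos ε 0<ε ε≤δ) , λ x<0 → ⊥-elim (<-asym 0<x x<0)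
  forSmall-keepsSign x y | tri≈ _ 0≡x _ =
    1# , 0<1 , λ _ _ _ → (λ 0<x → ⊥-elim (<-irrefl 0≡x 0<x)) , (λ x<0 → ⊥-elim (<-irrefl (sym 0≡x) x<0))
  forSmall-keepsSign x y | tri> _ _ x<0 with forSmall-pos (- y) (x<0⇒0<-x x<0)
  ...   | δ , 0<δ , pos = δ , 0<δ , λ ε 0<ε ε≤δ →
    (λ 0<x → ⊥-elim (<-asym 0<x x<0)) , λ _ → 0<-x⇒x<0 (subst (0# <_) (-x-εy ε) (pos ε 0<ε ε≤δ))
    where
    -x-εy : ∀ ε → - x + ε * (- y) ≡ - (x + ε * y)
    -x-εy ε = trans (cong (- x +_) (sym (-‿distribʳ-* ε y))) (⁻¹-∙-comm x (ε * y))

  forSmall-× : ∀ {P Q : Carrier → Set} → ForSmall P → ForSmall Q → ForSmall (λ ε → P ε × Q ε)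
  forSmall-× (δ₁ , 0<δ₁ , p) (δ₂ , 0<δ₂ , q) with compare δ₁ δ₂
  ... | tri< δ₁<δ₂ _ _ = δ₁ , 0<δ₁ , λ ε 0<ε ε≤δ₁ → p ε 0<ε ε≤δ₁ , q ε 0<ε (≤-trans ε≤δ₁ (inj₁ δ₁<δ₂))
  ... | tri≈ _ δ₁≡δ₂ _ = δ₁ , 0<δ₁ , λ ε 0<ε ε≤δ₁ → p ε 0<ε ε≤δ₁ , q ε 0<ε (≤-trans ε≤δ₁ (inj₂ δ₁≡δ₂))
  ... | tri> _ _ δ₂<δ₁ = δ₂ , 0<δ₂ , λ ε 0<ε ε≤δ₂ → p ε 0<ε (≤-trans ε≤δ₂ (inj₁ δ₂<δ₁)) , q ε 0<ε ε≤δ₂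

  forSmall-keepsSign-all : ∀ {m} (x y : Fin m → Carrier) → ForSmall (λ ε → ∀ i → KeepsSign (x i) (y i) ε)
  forSmall-keepsSign-all {zero} x y = 1# , 0<1 , λ _ _ _ ()
  forSmall-keepsSign-all {suc m} x y
    with forSmall-× (forSmall-keepsSign (x zero) (y zero))
                    (forSmall-keepsSign-all (λ i → x (suc i)) (λ i → y (suc i)))
  ... | δ , 0<δ , keeps = δ , 0<δ , λ where
    ε 0<ε ε≤δ zero    → proj₁ (keeps ε 0<ε ε≤δ)
    ε 0<ε ε≤δ (suc i) → proj₂ (keeps ε 0<ε ε≤δ) i

module CoordinateSpace (ℝ : RealField) where
  open OrderedFieldProperties ℝ public

  infixl 6 _⊞_
  infixr 7 _⊙_

  _⊞_ : ∀ {k} → Vec Carrier k → Vec Carrier k → Vec Carrier k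
  _⊞_ = zipWith _+_

  _⊙_ : ∀ {k} → Carrier → Vec Carrier k → Vec Carrier k
  c ⊙ v = map (c *_) v

  𝟘 : ∀ {k} → Vec Carrier k
  𝟘 {k} = replicate k 0#

  infix 8 _·_
  _·_ : ∀ {k} → Vec Carrier k → Vec Carrier k → Carrier
  _·_ = dot ℝ

  ⊞-comm : ∀ {k} (u w : Vec Carrier k) → u ⊞ w ≡ w ⊞ u
  ⊞-comm [] [] = refl
  ⊞-comm (x ∷ u) (y ∷ w) = cong₂ _∷_ (+-comm x y) (⊞-comm u w)

  ⊞-assoc : ∀ {k} (u v w : Vec Carrier k) → (u ⊞ v) ⊞ w ≡ u ⊞ (v ⊞ w)
  ⊞-assoc [] [] [] = refl
  ⊞-assoc (x ∷ u) (y ∷ v) (z ∷ w) = cong₂ _∷_ (+-assoc x y z) (⊞-assoc u v w)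

  ⊞-identityʳ : ∀ {k} (u : Vec Carrier k) → u ⊞ 𝟘 ≡ u
  ⊞-identityʳ [] = refl
  ⊞-identityʳ (x ∷ u) = cong₂ _∷_ (+-identityʳ x) (⊞-identityʳ u)

  ⊞-identityˡ : ∀ {k} (u : Vec Carrier k) → 𝟘 ⊞ u ≡ u
  ⊞-identityˡ u = trans (⊞-comm 𝟘 u) (⊞-identityʳ u)

  ⊞-interchange : ∀ {k} (a b c d : Vec Carrier k) → (a ⊞ b) ⊞ (c ⊞ d) ≡ (a ⊞ c) ⊞ (b ⊞ d)
  ⊞-interchange [] [] [] [] = refl
  ⊞-interchange (a ∷ as) (b ∷ bs) (c ∷ cs) (d ∷ ds) =
    cong₂ _∷_ (interchange a b c d) (⊞-interchange as bs cs ds)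

  ⊞-leftSwap : ∀ {k} (a b c : Vec Carrier k) → a ⊞ (b ⊞ c) ≡ b ⊞ (a ⊞ c)
  ⊞-leftSwap [] [] [] = refl
  ⊞-leftSwap (a ∷ as) (b ∷ bs) (c ∷ cs) = cong₂ _∷_ (x∙yz≈y∙xz a b c) (⊞-leftSwap as bs cs)

  ⊙-distribˡ-⊞ : ∀ {k} c (u w : Vec Carrier k) → c ⊙ (u ⊞ w) ≡ c ⊙ u ⊞ c ⊙ w
  ⊙-distribˡ-⊞ c [] [] = refl
  ⊙-distribˡ-⊞ c (x ∷ u) (y ∷ w) = cong₂ _∷_ (distribˡ c x y) (⊙-distribˡ-⊞ c u w)

  ⊙-distribʳ-+ : ∀ {k} c d (u : Vec Carrier k) → (c + d) ⊙ u ≡ c ⊙ u ⊞ d ⊙ u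
  ⊙-distribʳ-+ c d [] = refl
  ⊙-distribʳ-+ c d (x ∷ u) = cong₂ _∷_ (distribʳ x c d) (⊙-distribʳ-+ c d u)

  ⊙-assoc : ∀ {k} c d (u : Vec Carrier k) → (c * d) ⊙ u ≡ c ⊙ (d ⊙ u)
  ⊙-assoc c d [] = refl
  ⊙-assoc c d (x ∷ u) = cong₂ _∷_ (*-assoc c d x) (⊙-assoc c d u)

  ⊞-split : ∀ {k} t (v w : Vec Carrier k) → v ≡ t ⊙ w ⊞ (v ⊞ (- t) ⊙ w)
  ⊞-split t [] [] = refl
  ⊞-split t (a ∷ v) (b ∷ w) = cong₂ _∷_ (sym tb+[a-tb]≡a) (⊞-split t v w)
    where
    tb+[a-tb]≡a : t * b + (a + (- t) * b) ≡ a
    tb+[a-tb]≡a = begin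
      t * b + (a + (- t) * b)    ≡⟨ cong (λ z → t * b + (a + z)) (-x*y≡-[x*y] t b) ⟩
      t * b + (a + - (t * b))    ≡⟨ x∙yz≈y∙xz (t * b) a _ ⟩
      a + (t * b + - (t * b))    ≡⟨ cong (a +_) (-‿inverseʳ (t * b)) ⟩
      a + 0#                     ≡⟨ +-identityʳ a ⟩
      a                          ∎
      where open ≡-Reasoning

  ⊙-zeroʳ : ∀ {k} c → c ⊙ 𝟘 {k} ≡ 𝟘
  ⊙-zeroʳ {zero} c = refl
  ⊙-zeroʳ {suc k} c = cong₂ _∷_ (zeroʳ c) (⊙-zeroʳ c)

  ⊙-zeroˡ : ∀ {k} (u : Vec Carrier k) → 0# ⊙ u ≡ 𝟘
  ⊙-zeroˡ [] = refl
  ⊙-zeroˡ (x ∷ u) = cong₂ _∷_ (zeroˡ x) (⊙-zeroˡ u)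

  linComb : ∀ {k m} → Vec (Vec Carrier k) m → Vec Carrier m → Vec Carrier k
  linComb [] [] = 𝟘
  linComb (y ∷ Y) (c ∷ cs) = c ⊙ y ⊞ linComb Y cs

  linComb-⊞ : ∀ {k m} (Y : Vec (Vec Carrier k) m) u w → linComb Y (u ⊞ w) ≡ linComb Y u ⊞ linComb Y w
  linComb-⊞ [] [] [] = sym (⊞-identityʳ 𝟘)
  linComb-⊞ (y ∷ Y) (a ∷ u) (b ∷ w) =
    trans (cong₂ _⊞_ (⊙-distribʳ-+ a b y) (linComb-⊞ Y u w)) (⊞-interchange _ _ _ _)

  linComb-⊙ : ∀ {k m} (Y : Vec (Vec Carrier k) m) c u → linComb Y (c ⊙ u) ≡ c ⊙ linComb Y u
  linComb-⊙ [] c [] = sym (⊙-zeroʳ c)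
  linComb-⊙ (y ∷ Y) c (a ∷ u) =
    trans (cong₂ _⊞_ (⊙-assoc c a y) (linComb-⊙ Y c u)) (sym (⊙-distribˡ-⊞ c _ _))

  linComb-𝟘 : ∀ {k m} (Y : Vec (Vec Carrier k) m) → linComb Y 𝟘 ≡ 𝟘
  linComb-𝟘 [] = refl
  linComb-𝟘 (y ∷ Y) = trans (cong₂ _⊞_ (⊙-zeroˡ y) (linComb-𝟘 Y)) (⊞-identityʳ 𝟘)

  AllZero : ∀ {m} → Vec Carrier m → Set
  AllZero c = ∀ j → lookup c j ≡ 0#

  linComb-allZero : ∀ {k m} (Y : Vec (Vec Carrier k) m) c → AllZero c → linComb Y c ≡ 𝟘
  linComb-allZero [] [] _ = refl
  linComb-allZero (y ∷ Y) (c ∷ cs) c≡0 =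
    trans (cong₂ _⊞_ (trans (cong (_⊙ y) (c≡0 zero)) (⊙-zeroˡ y)) (linComb-allZero Y cs (c≡0 ∘ suc)))
          (⊞-identityʳ 𝟘)

  linComb-linComb : ∀ {k l m} (Y : Vec (Vec Carrier k) l) (X : Vec (Vec Carrier k) m) (A : Vec (Vec Carrier l) m) →
                    (∀ j → lookup X j ≡ linComb Y (lookup A j)) → ∀ d → linComb X d ≡ linComb Y (linComb A d)
  linComb-linComb Y [] [] _ [] = sym (linComb-𝟘 Y)
  linComb-linComb Y (x ∷ X) (a ∷ A) X≡YA (c ∷ d) = begin
    c ⊙ x ⊞ linComb X d                           ≡⟨ cong₂ _⊞_ (cong (c ⊙_) (X≡YA zero))
                                                               (linComb-linComb Y X A (X≡YA ∘ suc) d) ⟩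
    c ⊙ linComb Y a ⊞ linComb Y (linComb A d)     ≡⟨ cong (_⊞ _) (sym (linComb-⊙ Y c a)) ⟩
    linComb Y (c ⊙ a) ⊞ linComb Y (linComb A d)   ≡⟨ sym (linComb-⊞ Y _ _) ⟩
    linComb Y (c ⊙ a ⊞ linComb A d)               ∎
    where open ≡-Reasoning

  linComb-heads : ∀ {l m} (R : Vec (Vec Carrier (suc l)) m) c →
                  linComb R c ≡ c · map head R ∷ linComb (map tail R) c
  linComb-heads [] [] = refl
  linComb-heads ((h ∷ t) ∷ R) (c ∷ cs) = cong (zipWith _+_ (c * h ∷ c ⊙ t)) (linComb-heads R cs)

  linComb-shear : ∀ {k m} (φ : Vec Carrier k → Carrier) (R : Vec (Vec Carrier k) m) (z : Vec Carrier k) c →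
                  linComb (map (λ r → r ⊞ φ r ⊙ z) R) c ≡ linComb R c ⊞ (c · map φ R) ⊙ z
  linComb-shear φ [] z [] = trans (sym (⊞-identityʳ 𝟘)) (cong (𝟘 ⊞_) (sym (⊙-zeroˡ z)))
  linComb-shear φ (r ∷ R) z (c ∷ cs) = begin
    c ⊙ (r ⊞ φ r ⊙ z) ⊞ linComb (map (λ r → r ⊞ φ r ⊙ z) R) cs
      ≡⟨ cong₂ _⊞_ (trans (⊙-distribˡ-⊞ c r _) (cong (c ⊙ r ⊞_) (sym (⊙-assoc c (φ r) z))))
                   (linComb-shear φ R z cs) ⟩
    (c ⊙ r ⊞ (c * φ r) ⊙ z) ⊞ (linComb R cs ⊞ σ ⊙ z)
      ≡⟨ ⊞-interchange _ _ _ _ ⟩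
    (c ⊙ r ⊞ linComb R cs) ⊞ ((c * φ r) ⊙ z ⊞ σ ⊙ z)
      ≡⟨ cong ((c ⊙ r ⊞ linComb R cs) ⊞_) (sym (⊙-distribʳ-+ _ _ z)) ⟩
    (c ⊙ r ⊞ linComb R cs) ⊞ (c * φ r + σ) ⊙ z ∎
    where
    open ≡-Reasoning
    σ = cs · map φ R

  linComb-insertAt : ∀ {k m} (R : Vec (Vec Carrier k) (suc m)) c j e →
                     linComb R (insertAt c j e) ≡ e ⊙ lookup R j ⊞ linComb (removeAt R j) c
  linComb-insertAt (r ∷ R) c zero e = refl
  linComb-insertAt (r ∷ y ∷ R) (c ∷ cs) (suc j) e =
    trans (cong (c ⊙ r ⊞_) (linComb-insertAt (y ∷ R) cs j e)) (⊞-leftSwap _ _ _)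

  allZero-insertAt : ∀ {m} (c : Vec Carrier m) j e → AllZero (insertAt c j e) → AllZero c
  allZero-insertAt c j e c'≡0 i = trans (sym (insertAt-punchIn c j e i)) (c'≡0 (punchIn j i))

  ·-allZeroʳ : ∀ {m} (d a : Vec Carrier m) → AllZero a → d · a ≡ 0#
  ·-allZeroʳ [] [] _ = refl
  ·-allZeroʳ (d ∷ ds) (a ∷ as) a≡0 =
    trans (cong₂ _+_ (trans (cong (d *_) (a≡0 zero)) (zeroʳ d)) (·-allZeroʳ ds as (a≡0 ∘ suc)))
          (+-identityʳ 0#)

  linComb-tails : ∀ {l m} (R : Vec (Vec Carrier (suc l)) m) → (∀ j → head (lookup R j) ≡ 0#) →
                  ∀ c → linComb (map tail R) c ≡ 𝟘 → linComb R c ≡ 𝟘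
  linComb-tails R heads≡0 c tails≡0 = trans (linComb-heads R c) (cong₂ _∷_ (·-allZeroʳ c _ mapHeads≡0) tails≡0)
    where
    mapHeads≡0 : AllZero (map head R)
    mapHeads≡0 j = trans (lookup-map j head R) (heads≡0 j)

  clearColumn : ∀ {l m} (R : Vec (Vec Carrier (suc l)) (suc m)) j → head (lookup R j) ≢ 0# →
                Vec (Vec Carrier (suc l)) m
  clearColumn R j α≢0 = map (λ r → r ⊞ (- (head r * proj₁ (inverse _ α≢0))) ⊙ lookup R j) (removeAt R j)

  clearColumn-heads : ∀ {l m} (R : Vec (Vec Carrier (suc l)) (suc m)) j (α≢0 : head (lookup R j) ≢ 0#) →
                      ∀ i → head (lookup (clearColumn R j α≢0) i) ≡ 0#
  clearColumn-heads R j α≢0 i = begin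
    head (lookup (clearColumn R j α≢0) i)  ≡⟨ cong head (lookup-map i _ (removeAt R j)) ⟩
    head (r ⊞ (- (head r * α⁻¹)) ⊙ p)      ≡⟨ head-⊞⊙ r p ⟩
    head r + (- (head r * α⁻¹)) * head p   ≡⟨ eliminate (head r) (head p) (inverse _ α≢0) ⟩
    0#                                     ∎
    where
    open ≡-Reasoning
    r = lookup (removeAt R j) i
    p = lookup R j
    α⁻¹ = proj₁ (inverse _ α≢0)
    head-⊞⊙ : ∀ {l} (u w : Vec Carrier (suc l)) {c} → head (u ⊞ c ⊙ w) ≡ head u + c * head w
    head-⊞⊙ (_ ∷ _) (_ ∷ _) = refl

  Independent : ∀ {k m} → Vec (Vec Carrier k) m → Set
  Independent R = ∀ c → linComb R c ≡ 𝟘 → AllZero c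

  independent-tails : ∀ {l m} (R : Vec (Vec Carrier (suc l)) m) → (∀ j → head (lookup R j) ≡ 0#) →
                      Independent R → Independent (map tail R)
  independent-tails R heads≡0 ind c tails≡0 = ind c (linComb-tails R heads≡0 c tails≡0)

  independent-clearColumn : ∀ {l m} (R : Vec (Vec Carrier (suc l)) (suc m)) j (α≢0 : head (lookup R j) ≢ 0#) →
                            Independent R → Independent (map tail (clearColumn R j α≢0))
  independent-clearColumn R j α≢0 ind c tails≡0 = allZero-insertAt c j σ (ind (insertAt c j σ) (begin
    linComb R (insertAt c j σ)                 ≡⟨ linComb-insertAt R c j σ ⟩
    σ ⊙ lookup R j ⊞ linComb (removeAt R j) c  ≡⟨ ⊞-comm _ _ ⟩
    linComb (removeAt R j) c ⊞ σ ⊙ lookup R j  ≡⟨ sym (linComb-shear φ (removeAt R j) (lookup R j) c) ⟩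
    linComb (clearColumn R j α≢0) c            ≡⟨ linComb-tails (clearColumn R j α≢0)
                                                                (clearColumn-heads R j α≢0) c tails≡0 ⟩
    𝟘                                          ∎))
    where
    open ≡-Reasoning
    φ : Vec Carrier _ → Carrier
    φ r = - (head r * proj₁ (inverse _ α≢0))
    σ = c · map φ (removeAt R j)

  independent⇒length≤dim : ∀ {l m} (R : Vec (Vec Carrier l) m) → Independent R → m ℕ.≤ l
  independent⇒length≤dim {zero} [] _ = z≤n
  independent⇒length≤dim {zero} (r ∷ R) ind = ⊥-elim (0≢1 (sym (ind (1# ∷ 𝟘) (vec0 _) zero)))
    where
    vec0 : (v : Vec Carrier 0) → v ≡ []
    vec0 [] = refl
  independent⇒length≤dim {suc l} [] _ = z≤n
  independent⇒length≤dim {suc l} R@(_ ∷ _) ind with all? (λ j → head (lookup R j) ≟ 0#)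
  ... | yes heads≡0 = ℕP.m≤n⇒m≤1+n (independent⇒length≤dim (map tail R) (independent-tails R heads≡0 ind))
  ... | no ¬heads≡0 with ¬∀⟶∃¬ _ _ (λ j → head (lookup R j) ≟ 0#) ¬heads≡0
  ...   | j , α≢0 =
    s≤s (independent⇒length≤dim (map tail (clearColumn R j α≢0)) (independent-clearColumn R j α≢0 ind))

module Functionals (ℝ : RealField) where
  open CoordinateSpace ℝ public

  ·-distribˡ-⊞ : ∀ {r} (f u w : Vec Carrier r) → f · (u ⊞ w) ≡ f · u + f · w
  ·-distribˡ-⊞ [] [] [] = sym (+-identityʳ 0#)
  ·-distribˡ-⊞ (x ∷ f) (a ∷ u) (b ∷ w) =
    trans (cong₂ _+_ (distribˡ x a b) (·-distribˡ-⊞ f u w)) (interchange _ _ _ _)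

  ·-distribʳ-⊞ : ∀ {r} (f g v : Vec Carrier r) → (f ⊞ g) · v ≡ f · v + g · v
  ·-distribʳ-⊞ [] [] [] = sym (+-identityʳ 0#)
  ·-distribʳ-⊞ (x ∷ f) (y ∷ g) (a ∷ v) =
    trans (cong₂ _+_ (distribʳ a x y) (·-distribʳ-⊞ f g v)) (interchange _ _ _ _)

  ·-⊙ˡ : ∀ {r} c (g v : Vec Carrier r) → (c ⊙ g) · v ≡ c * (g · v)
  ·-⊙ˡ c [] [] = sym (zeroʳ c)
  ·-⊙ˡ c (x ∷ g) (a ∷ v) = trans (cong₂ _+_ (*-assoc c x a) (·-⊙ˡ c g v)) (sym (distribˡ c _ _))

  ·-⊙ʳ : ∀ {r} c (f u : Vec Carrier r) → f · (c ⊙ u) ≡ c * (f · u)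
  ·-⊙ʳ c [] [] = sym (zeroʳ c)
  ·-⊙ʳ c (x ∷ f) (a ∷ u) = trans (cong₂ _+_ x[ca]≡c[xa] (·-⊙ʳ c f u)) (sym (distribˡ c _ _))
    where
    x[ca]≡c[xa] : x * (c * a) ≡ c * (x * a)
    x[ca]≡c[xa] = trans (sym (*-assoc x c a)) (trans (cong (_* a) (*-comm x c)) (*-assoc c x a))

  ⊞⊙-· : ∀ {r} (f : Vec Carrier r) c g v → (f ⊞ c ⊙ g) · v ≡ f · v + c * (g · v)
  ⊞⊙-· f c g v = trans (·-distribʳ-⊞ f (c ⊙ g) v) (cong (f · v +_) (·-⊙ˡ c g v))

  ·-𝟘ʳ : ∀ {r} (f : Vec Carrier r) → f · 𝟘 ≡ 0#
  ·-𝟘ʳ [] = refl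
  ·-𝟘ʳ (x ∷ f) = trans (cong₂ _+_ (zeroʳ x) (·-𝟘ʳ f)) (+-identityʳ 0#)

  ·-𝟘ˡ : ∀ {r} (v : Vec Carrier r) → 𝟘 · v ≡ 0#
  ·-𝟘ˡ [] = refl
  ·-𝟘ˡ (x ∷ v) = trans (cong₂ _+_ (zeroˡ x) (·-𝟘ˡ v)) (+-identityʳ 0#)

  Annihilates : ∀ {r k} → Vec Carrier r → Vec (Vec Carrier r) k → Set
  Annihilates g Y = ∀ j → g · lookup Y j ≡ 0#

  annihilates-linComb : ∀ {r k} g (Y : Vec (Vec Carrier r) k) c → Annihilates g Y → g · linComb Y c ≡ 0#
  annihilates-linComb g [] [] _ = ·-𝟘ʳ g
  annihilates-linComb g (y ∷ Y) (c ∷ cs) gY≡0 = begin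
    g · (c ⊙ y ⊞ linComb Y cs)        ≡⟨ ·-distribˡ-⊞ g _ _ ⟩
    g · (c ⊙ y) + g · linComb Y cs    ≡⟨ cong₂ _+_ (·-⊙ʳ c g y) (annihilates-linComb g Y cs (gY≡0 ∘ suc)) ⟩
    c * (g · y) + 0#                  ≡⟨ cong (λ z → c * z + 0#) (gY≡0 zero) ⟩
    c * 0# + 0#                       ≡⟨ cong (_+ 0#) (zeroʳ c) ⟩
    0# + 0#                           ≡⟨ +-identityʳ 0# ⟩
    0#                                ∎
    where open ≡-Reasoning

  InLinSpan : ∀ {r k} → Vec (Vec Carrier r) k → Vec Carrier r → Set
  InLinSpan Y v = Σ (Vec Carrier _) λ c → v ≡ linComb Y c

  Separated : ∀ {r k} → Vec (Vec Carrier r) k → Vec Carrier r → Set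
  Separated Y v = Σ (Vec Carrier _) λ g → Annihilates g Y × g · v ≢ 0#

  annihilates-inLinSpan : ∀ {r k} g (Y : Vec (Vec Carrier r) k) → Annihilates g Y →
                          ∀ {v} → InLinSpan Y v → g · v ≡ 0#
  annihilates-inLinSpan g Y gY≡0 (c , v≡Yc) = trans (cong (g ·_) v≡Yc) (annihilates-linComb g Y c gY≡0)

  inLinSpan⇒¬separated : ∀ {r k} (Y : Vec (Vec Carrier r) k) v → InLinSpan Y v → ¬ Separated Y v
  inLinSpan⇒¬separated Y v v∈Y (g , gY≡0 , gv≢0) = gv≢0 (annihilates-inLinSpan g Y gY≡0 v∈Y)

  nonzero-detected : ∀ {r} (v : Vec Carrier r) → v ≢ 𝟘 → Σ (Vec Carrier r) λ g → g · v ≢ 0#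
  nonzero-detected [] v≢0 = ⊥-elim (v≢0 refl)
  nonzero-detected (x ∷ v) xv≢0 with x ≟ 0#
  ... | no x≢0 = (1# ∷ 𝟘) , λ gv≡0 → x≢0 (trans (sym [1∷𝟘]·v≡x) gv≡0)
    where
    [1∷𝟘]·v≡x : 1# * x + 𝟘 · v ≡ x
    [1∷𝟘]·v≡x = trans (cong (1# * x +_) (·-𝟘ˡ v)) (trans (+-identityʳ _) (*-identityˡ x))
  ... | yes x≡0 with ≡-dec _≟_ v 𝟘
  ...   | yes v≡0 = ⊥-elim (xv≢0 (cong₂ _∷_ x≡0 v≡0))
  ...   | no v≢0 with nonzero-detected v v≢0
  ...     | g , gv≢0 = (0# ∷ g) , λ gv≡0 → gv≢0 (trans (sym [0∷g]·v≡g·v) gv≡0)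
    where
    [0∷g]·v≡g·v : 0# * x + g · v ≡ g · v
    [0∷g]·v≡g·v = trans (cong (_+ g · v) (zeroˡ x)) (+-identityˡ _)

  SpanOrSeparated : ∀ {r k} → Vec (Vec Carrier r) k → Set
  SpanOrSeparated Y = ∀ v → InLinSpan Y v ⊎ Separated Y v

  spanOrSeparated-cons-dependent : ∀ {r k} {Y : Vec (Vec Carrier r) k} {w} →
    InLinSpan Y w → SpanOrSeparated Y → SpanOrSeparated (w ∷ Y)
  spanOrSeparated-cons-dependent {Y = Y} {w} w∈Y decideY v with decideY v
  ... | inj₁ (c , v≡Yc) = inj₁ ((0# ∷ c) , trans v≡Yc (sym 0w+Yc≡Yc))
    where
    0w+Yc≡Yc : 0# ⊙ w ⊞ linComb Y c ≡ linComb Y c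
    0w+Yc≡Yc = trans (cong (_⊞ linComb Y c) (⊙-zeroˡ w)) (⊞-identityˡ _)
  ... | inj₂ (g , gY≡0 , gv≢0) = inj₂ (g , gwY≡0 , gv≢0)
    where
    gwY≡0 : Annihilates g (w ∷ Y)
    gwY≡0 zero = annihilates-inLinSpan g Y gY≡0 w∈Y
    gwY≡0 (suc j) = gY≡0 j

  -- With β = g₂·w ≠ 0, decide v - (g₂·v / β) w against Y; a separating g₁ is corrected to g₁ - (g₁·w / β) g₂.
  spanOrSeparated-cons-separated : ∀ {r k} {Y : Vec (Vec Carrier r) k} {w} →
    Separated Y w → SpanOrSeparated Y → SpanOrSeparated (w ∷ Y)
  spanOrSeparated-cons-separated {Y = Y} {w} (g₂ , g₂Y≡0 , β≢0) decideY v = conclude (decideY (v ⊞ (- t) ⊙ w))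
    where
    β⁻¹ = inverse (g₂ · w) β≢0
    t = (g₂ · v) * proj₁ β⁻¹
    open ≡-Reasoning

    conclude : InLinSpan Y (v ⊞ (- t) ⊙ w) ⊎ Separated Y (v ⊞ (- t) ⊙ w) →
               InLinSpan (w ∷ Y) v ⊎ Separated (w ∷ Y) v
    conclude (inj₁ (c , v-tw≡Yc)) = inj₁ ((t ∷ c) , trans (⊞-split t v w) (cong (t ⊙ w ⊞_) v-tw≡Yc))
    conclude (inj₂ (g₁ , g₁Y≡0 , g₁[v-tw]≢0)) = inj₂ (g , gwY≡0 , gv≢0)
      where
      s = (g₁ · w) * proj₁ β⁻¹
      g = g₁ ⊞ (- s) ⊙ g₂
      g·x≡ : ∀ x → g · x ≡ g₁ · x + (- s) * (g₂ · x)
      g·x≡ = ⊞⊙-· g₁ (- s) g₂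
      gwY≡0 : Annihilates g (w ∷ Y)
      gwY≡0 zero = trans (g·x≡ w) (eliminate (g₁ · w) (g₂ · w) β⁻¹)
      gwY≡0 (suc j) = begin
        g · lookup Y j                                    ≡⟨ g·x≡ (lookup Y j) ⟩
        g₁ · lookup Y j + (- s) * (g₂ · lookup Y j)       ≡⟨ cong₂ (λ a b → a + (- s) * b) (g₁Y≡0 j) (g₂Y≡0 j) ⟩
        0# + (- s) * 0#                                   ≡⟨ trans (+-identityˡ _) (zeroʳ _) ⟩
        0#                                                ∎
      gv≡g₁[v-tw] : g · v ≡ g₁ · (v ⊞ (- t) ⊙ w)
      gv≡g₁[v-tw] = begin
        g · v                              ≡⟨ g·x≡ v ⟩
        g₁ · v + (- s) * (g₂ · v)          ≡⟨ cong (g₁ · v +_) (-[xy]z≡-[zy]x (g₁ · w) (proj₁ β⁻¹) (g₂ · v)) ⟩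
        g₁ · v + (- t) * (g₁ · w)          ≡⟨ cong (g₁ · v +_) (sym (·-⊙ʳ (- t) g₁ w)) ⟩
        g₁ · v + g₁ · ((- t) ⊙ w)          ≡⟨ sym (·-distribˡ-⊞ g₁ v _) ⟩
        g₁ · (v ⊞ (- t) ⊙ w)               ∎
      gv≢0 : g · v ≢ 0#
      gv≢0 gv≡0 = g₁[v-tw]≢0 (trans (sym gv≡g₁[v-tw]) gv≡0)

  spanOrSeparated : ∀ {r k} (Y : Vec (Vec Carrier r) k) → SpanOrSeparated Y
  spanOrSeparated [] v with ≡-dec _≟_ v 𝟘
  ... | yes v≡0 = inj₁ ([] , v≡0)
  ... | no v≢0 = let (g , gv≢0) = nonzero-detected v v≢0 in inj₂ (g , (λ ()) , gv≢0)
  spanOrSeparated (w ∷ Y) with spanOrSeparated Y w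
  ... | inj₁ w∈Y = spanOrSeparated-cons-dependent w∈Y (spanOrSeparated Y)
  ... | inj₂ w∉Y = spanOrSeparated-cons-separated w∉Y (spanOrSeparated Y)

  independent-inLinSpan⇒length≤ : ∀ {r k l} (X : Vec (Vec Carrier r) k) (Y : Vec (Vec Carrier r) l) →
    Independent X → (∀ j → InLinSpan Y (lookup X j)) → k ℕ.≤ l
  independent-inLinSpan⇒length≤ X Y indX X⊆Y = independent⇒length≤dim A indA
    where
    A = tabulate (λ j → proj₁ (X⊆Y j))
    X≡YA : ∀ j → lookup X j ≡ linComb Y (lookup A j)
    X≡YA j = trans (proj₂ (X⊆Y j)) (cong (linComb Y) (sym (lookup∘tabulate _ j)))
    indA : Independent A
    indA d Ad≡0 = indX d (trans (linComb-linComb Y X A X≡YA d) (trans (cong (linComb Y) Ad≡0) (linComb-𝟘 Y)))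

  linComb-++ : ∀ {r k l} (X : Vec (Vec Carrier r) k) (Y : Vec (Vec Carrier r) l) c d →
               linComb (X ++ Y) (c ++ d) ≡ linComb X c ⊞ linComb Y d
  linComb-++ [] Y [] d = sym (⊞-identityˡ _)
  linComb-++ (x ∷ X) Y (c ∷ cs) d = trans (cong (c ⊙ x ⊞_) (linComb-++ X Y cs d)) (sym (⊞-assoc _ _ _))

  allZero-++ : ∀ {k l} (c : Vec Carrier k) (d : Vec Carrier l) → AllZero c → AllZero d → AllZero (c ++ d)
  allZero-++ [] d _ d≡0 = d≡0
  allZero-++ (c ∷ cs) d c≡0 d≡0 zero = c≡0 zero
  allZero-++ (c ∷ cs) d c≡0 d≡0 (suc j) = allZero-++ cs d (c≡0 ∘ suc) d≡0 j

  annihilates-++ˡ : ∀ {r k l} g (X : Vec (Vec Carrier r) k) (Y : Vec (Vec Carrier r) l) →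
                    Annihilates g (X ++ Y) → Annihilates g X
  annihilates-++ˡ g X Y gXY≡0 j = trans (cong (g ·_) (sym (lookup-++ˡ X Y j))) (gXY≡0 _)

  annihilates-++ʳ : ∀ {r k l} g (X : Vec (Vec Carrier r) k) (Y : Vec (Vec Carrier r) l) →
                    Annihilates g (X ++ Y) → Annihilates g Y
  annihilates-++ʳ g X Y gXY≡0 j = trans (cong (g ·_) (sym (lookup-++ʳ X Y j))) (gXY≡0 _)

  ⊞≡𝟘⇒≡-1⊙ : ∀ {k} (a b : Vec Carrier k) → a ⊞ b ≡ 𝟘 → b ≡ (- 1#) ⊙ a
  ⊞≡𝟘⇒≡-1⊙ [] [] _ = refl
  ⊞≡𝟘⇒≡-1⊙ (x ∷ a) (y ∷ b) xa+yb≡0 =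
    cong₂ _∷_ (trans (inverseʳ-unique x y (cong head xa+yb≡0)) (sym (-1*x≡-x x)))
              (⊞≡𝟘⇒≡-1⊙ a b (cong tail xa+yb≡0))

module Configuration (ℝ : RealField) {r n : ℕ} (V : Fin n → Vec (RealField.Carrier ℝ) r) where
  open Functionals ℝ public

  lincomb≡linComb : ∀ {k} (idx : Vec (Fin n) k) c → lincomb ℝ V idx c ≡ linComb (map V idx) c
  lincomb≡linComb [] [] = refl
  lincomb≡linComb (i ∷ idx) (c ∷ cs) = cong (c ⊙ V i ⊞_) (lincomb≡linComb idx cs)

  inSpan-linComb : ∀ {S k} (idx : Vec (Fin n) k) → AllIn ℝ V S idx → ∀ c → InSpan ℝ V S (linComb (map V idx) c)
  inSpan-linComb idx idx⊆S c = _ , idx , idx⊆S , c , sym (lincomb≡linComb idx c)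

  inSpan∅⇒≡𝟘 : ∀ {x} → InSpan ℝ V ∅ x → x ≡ 𝟘
  inSpan∅⇒≡𝟘 (zero , [] , _ , [] , x≡0) = x≡0
  inSpan∅⇒≡𝟘 (suc k , i ∷ idx , idx⊆∅ , c , _) = ⊥-elim (∉⊥ (idx⊆∅ zero))

  inSpan-mono : ∀ {S T x} → (∀ {i} → i ∈ S → i ∈ T) → InSpan ℝ V S x → InSpan ℝ V T x
  inSpan-mono S⊆T (k , idx , idx⊆S , c , x≡idx·c) = k , idx , S⊆T ∘ idx⊆S , c , x≡idx·c

  𝟘-inSpan : ∀ S → InSpan ℝ V S 𝟘
  𝟘-inSpan S = 0 , [] , (λ ()) , [] , refl

  AnnihilatesSet : Vec Carrier r → Subset n → Set
  AnnihilatesSet g S = ∀ i → i ∈ S → g · V i ≡ 0#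

  annihilatesSet⇒annihilates : ∀ g {S k} (idx : Vec (Fin n) k) → AllIn ℝ V S idx → AnnihilatesSet g S →
                               Annihilates g (map V idx)
  annihilatesSet⇒annihilates g idx idx⊆S gS≡0 j = trans (cong (g ·_) (lookup-map j V idx)) (gS≡0 _ (idx⊆S j))

  annihilatesSet-inSpan : ∀ g {S x} → AnnihilatesSet g S → InSpan ℝ V S x → g · x ≡ 0#
  annihilatesSet-inSpan g gS≡0 (k , idx , idx⊆S , c , x≡idx·c) =
    trans (cong (g ·_) (trans x≡idx·c (lincomb≡linComb idx c)))
          (annihilates-linComb g (map V idx) c (annihilatesSet⇒annihilates g idx idx⊆S gS≡0))

  independentMod∅⇒independent : ∀ {k} (idx : Vec (Fin n) k) → IndepMod ℝ V ∅ idx → Independent (map V idx)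
  independentMod∅⇒independent idx ind c Xc≡0 =
    ind c (subst (InSpan ℝ V ∅) (sym (trans (lincomb≡linComb idx c) Xc≡0)) (𝟘-inSpan ∅))

  independentMod-cons : ∀ {S k i} g (idx : Vec (Fin n) k) → IndepMod ℝ V S idx → AnnihilatesSet g S →
                        Annihilates g (map V idx) → g · V i ≢ 0# → IndepMod ℝ V S (i ∷ idx)
  independentMod-cons {S} {i = i} g idx ind gS≡0 gidx≡0 gVi≢0 (c₀ ∷ cs) c∈S = λ where
      zero → c₀≡0
      (suc j) → ind cs (subst (InSpan ℝ V S) drop-c₀ c∈S) j
    where
    open ≡-Reasoning
    c₀≡0 : c₀ ≡ 0#
    c₀≡0 = x*y≡0⇒x≡0 (begin
      c₀ * (g · V i)                                  ≡⟨ sym (+-identityʳ _) ⟩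
      c₀ * (g · V i) + 0#                             ≡⟨ cong₂ _+_ (sym (·-⊙ʳ c₀ g (V i)))
                                                           (sym (annihilates-linComb g (map V idx) cs gidx≡0)) ⟩
      g · (c₀ ⊙ V i) + g · linComb (map V idx) cs     ≡⟨ sym (·-distribˡ-⊞ g _ _) ⟩
      g · (c₀ ⊙ V i ⊞ linComb (map V idx) cs)         ≡⟨ cong (λ x → g · (c₀ ⊙ V i ⊞ x))
                                                              (sym (lincomb≡linComb idx cs)) ⟩
      g · lincomb ℝ V (i ∷ idx) (c₀ ∷ cs)             ≡⟨ annihilatesSet-inSpan g gS≡0 c∈S ⟩
      0#                                              ∎) gVi≢0
    drop-c₀ : lincomb ℝ V (i ∷ idx) (c₀ ∷ cs) ≡ lincomb ℝ V idx cs
    drop-c₀ = trans (cong (λ c → c ⊙ V i ⊞ lincomb ℝ V idx cs) c₀≡0)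
                    (trans (cong (_⊞ lincomb ℝ V idx cs) (⊙-zeroˡ (V i))) (⊞-identityˡ _))

  independentMod-++ : ∀ {W kW kQ} (BW : Vec (Fin n) kW) (BQ : Vec (Fin n) kQ) → AllIn ℝ V W BW →
                      IndepMod ℝ V ∅ BW → IndepMod ℝ V W BQ → IndepMod ℝ V ∅ (BW ++ BQ)
  independentMod-++ {W} {kW} BW BQ BW⊆W indW indQ c c∈∅ with splitAt kW c
  ... | c₁ , c₂ , refl = allZero-++ c₁ c₂ c₁≡0 c₂≡0
    where
    XW = map V BW
    XQ = map V BQ
    sum≡𝟘 : linComb XW c₁ ⊞ linComb XQ c₂ ≡ 𝟘
    sum≡𝟘 = begin
      linComb XW c₁ ⊞ linComb XQ c₂          ≡⟨ sym (linComb-++ XW XQ c₁ c₂) ⟩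
      linComb (XW ++ XQ) (c₁ ++ c₂)          ≡⟨ cong (λ X → linComb X (c₁ ++ c₂)) (sym (map-++ V BW BQ)) ⟩
      linComb (map V (BW ++ BQ)) (c₁ ++ c₂)  ≡⟨ sym (lincomb≡linComb (BW ++ BQ) (c₁ ++ c₂)) ⟩
      lincomb ℝ V (BW ++ BQ) (c₁ ++ c₂)      ≡⟨ inSpan∅⇒≡𝟘 c∈∅ ⟩
      𝟘                                      ∎
      where open ≡-Reasoning
    c₂≡0 : AllZero c₂
    c₂≡0 = indQ c₂ (subst (InSpan ℝ V W) XW[-c₁]≡XQc₂ (inSpan-linComb BW BW⊆W ((- 1#) ⊙ c₁)))
      where
      XW[-c₁]≡XQc₂ : linComb XW ((- 1#) ⊙ c₁) ≡ lincomb ℝ V BQ c₂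
      XW[-c₁]≡XQc₂ = trans (linComb-⊙ XW (- 1#) c₁)
                           (trans (sym (⊞≡𝟘⇒≡-1⊙ _ _ sum≡𝟘)) (sym (lincomb≡linComb BQ c₂)))
    c₁≡0 : AllZero c₁
    c₁≡0 = indW c₁ (subst (InSpan ℝ V ∅) (sym (trans (lincomb≡linComb BW c₁) XWc₁≡𝟘)) (𝟘-inSpan ∅))
      where
      XWc₁≡𝟘 : linComb XW c₁ ≡ 𝟘
      XWc₁≡𝟘 = trans (sym (⊞-identityʳ _))
                     (trans (cong (linComb XW c₁ ⊞_) (sym (linComb-allZero XQ c₂ c₂≡0))) sum≡𝟘)

  -- A functional separating V i from Y would extend B to a larger independent family.
  maximal⇒inLinSpan : ∀ {S U k} (((B , B⊆U , indB) , maximal) : IsRankMod ℝ V S U k)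
                      {l} (Y : Vec (Vec Carrier r) l) →
    (∀ g → Annihilates g Y → AnnihilatesSet g S × Annihilates g (map V B)) →
    ∀ i → i ∈ U → InLinSpan Y (V i)
  maximal⇒inLinSpan ((B , B⊆U , indB) , maximal) Y annihilates i i∈U with spanOrSeparated Y (V i)
  ... | inj₁ Vi∈Y = Vi∈Y
  ... | inj₂ (g , gY≡0 , gVi≢0) =
    ⊥-elim (ℕP.1+n≰n (maximal (i ∷ B) iB⊆U (independentMod-cons g B indB gS≡0 gB≡0 gVi≢0)))
    where
    gS≡0 = proj₁ (annihilates g gY≡0)
    gB≡0 = proj₂ (annihilates g gY≡0)
    iB⊆U : AllIn ℝ V _ (i ∷ B)
    iB⊆U zero = i∈U
    iB⊆U (suc j) = B⊆U j

  rank-additive : ∀ W {kV kW kQ} → IsRankMod ℝ V ∅ ⊤ kV → IsRankMod ℝ V ∅ W kW →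
                  IsRankMod ℝ V W (∁ W) kQ → kV ≡ kW ℕ.+ kQ
  rank-additive W ((BV , _ , indV) , maximalV) rkW@((BW , BW⊆W , indW) , _) rkQ@((BQ , _ , indQ) , _) =
    ℕP.≤-antisym
      (independent-inLinSpan⇒length≤ (map V BV) Y (independentMod∅⇒independent BV indV)
                                     (λ j → subst (InLinSpan Y) (sym (lookup-map j V BV)) (spans (lookup BV j))))
      (maximalV (BW ++ BQ) (λ _ → ∈⊤) (independentMod-++ BW BQ BW⊆W indW indQ))
    where
    Y = map V (BW ++ BQ)
    annihilates-split : ∀ g → Annihilates g Y → Annihilates g (map V BW) × Annihilates g (map V BQ)
    annihilates-split g gY≡0 =
      annihilates-++ˡ g (map V BW) (map V BQ) gWQ≡0 , annihilates-++ʳ g (map V BW) (map V BQ) gWQ≡0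
      where gWQ≡0 = subst (Annihilates g) (map-++ V BW BQ) gY≡0
    spansW : ∀ i → i ∈ W → InLinSpan Y (V i)
    spansW = maximal⇒inLinSpan rkW Y λ g gY≡0 → (λ _ → ⊥-elim ∘ ∉⊥) , proj₁ (annihilates-split g gY≡0)
    spansQ : ∀ i → i ∈ ∁ W → InLinSpan Y (V i)
    spansQ = maximal⇒inLinSpan rkQ Y λ g gY≡0 →
      (λ i i∈W → annihilates-inLinSpan g Y gY≡0 (spansW i i∈W)) ,
      proj₂ (annihilates-split g gY≡0)
    spans : ∀ i → InLinSpan Y (V i)
    spans i with i ∈? W
    ... | yes i∈W = spansW i i∈W
    ... | no i∉W = spansQ i (x∉p⇒x∈∁p i∉W)

data Sign : Set where
  pos nul neg : Sign

isPos isNul isNeg : Sign → Bool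
isPos pos = true
isPos _   = false
isNul nul = true
isNul _   = false
isNeg neg = true
isNeg _   = false

-- The sign of x + εy for all small ε > 0, given the signs of x and y.
perturb : Sign → Sign → Sign
perturb nul t = t
perturb s   _ = s

opposite : Sign → Sign
opposite pos = neg
opposite nul = nul
opposite neg = pos

module Counting {n : ℕ} where
  open import Algebra.Properties.CommutativeMonoid.Sum ℕP.+-0-commutativeMonoid public
    using (sum)
  open import Algebra.Properties.CommutativeMonoid.Sum ℕP.+-0-commutativeMonoid
    using (sum-cong-≗; ∑-distrib-+; sum-replicate-zero)

  𝟙 : Bool → ℕ
  𝟙 b = if b then 1 else 0

  count : Subset n → (Fin n → Bool) → ℕ
  count U p = sum (λ i → 𝟙 (lookup U i ∧ p i))

  size : Subset n → ℕ
  size U = count U (λ _ → true)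

  sum-mono-≤ : ∀ {m} {h₁ h₂ : Fin m → ℕ} → (∀ i → h₁ i ℕ.≤ h₂ i) → sum h₁ ℕ.≤ sum h₂
  sum-mono-≤ {zero} _ = z≤n
  sum-mono-≤ {suc m} h₁≤h₂ = ℕP.+-mono-≤ (h₁≤h₂ zero) (sum-mono-≤ (h₁≤h₂ ∘ suc))

  sum-mono-< : ∀ {m} {h₁ h₂ : Fin m → ℕ} → (∀ i → h₁ i ℕ.≤ h₂ i) → ∀ i → h₁ i ℕ.< h₂ i → sum h₁ ℕ.< sum h₂
  sum-mono-< {suc m} h₁≤h₂ zero h₁<h₂ = ℕP.+-mono-<-≤ h₁<h₂ (sum-mono-≤ (h₁≤h₂ ∘ suc))
  sum-mono-< {suc m} h₁≤h₂ (suc i) h₁<h₂ = ℕP.+-mono-≤-< (h₁≤h₂ zero) (sum-mono-< (h₁≤h₂ ∘ suc) i h₁<h₂)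

  count-cong : ∀ U {p q} → (∀ i → lookup U i ≡ true → p i ≡ q i) → count U p ≡ count U q
  count-cong U p≡q = sum-cong-≗ λ i → pointwise (lookup U i) (p≡q i)
    where
    pointwise : ∀ u {b c} → (u ≡ true → b ≡ c) → 𝟙 (u ∧ b) ≡ 𝟙 (u ∧ c)
    pointwise false _ = refl
    pointwise true b≡c = cong 𝟙 (b≡c refl)

  count-+ : ∀ U {p q r} → (∀ i → 𝟙 (p i) ℕ.+ 𝟙 (q i) ≡ 𝟙 (r i)) → count U p ℕ.+ count U q ≡ count U r
  count-+ U {p} {q} p+q≡r =
    trans (sym (∑-distrib-+ (λ i → 𝟙 (lookup U i ∧ p i)) (λ i → 𝟙 (lookup U i ∧ q i))))
          (sum-cong-≗ λ i → pointwise (lookup U i) (p+q≡r i))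
    where
    pointwise : ∀ u {b c d} → 𝟙 b ℕ.+ 𝟙 c ≡ 𝟙 d → 𝟙 (u ∧ b) ℕ.+ 𝟙 (u ∧ c) ≡ 𝟙 (u ∧ d)
    pointwise false _ = refl
    pointwise true b+c≡d = b+c≡d

  count-≡0 : ∀ U {p} → (∀ i → lookup U i ≡ true → p i ≡ false) → count U p ≡ 0
  count-≡0 U ¬p =
    trans (count-cong U ¬p) (trans (sum-cong-≗ λ i → cong 𝟙 (∧-zeroʳ (lookup U i))) (sum-replicate-zero n))

  count-⊆-⊤ : ∀ U {p} → (∀ i → p i ≡ true → lookup U i ≡ true) → count ⊤ p ≡ count U p
  count-⊆-⊤ U p⊆U = sum-cong-≗ λ i → pointwise (lookup-replicate i true) (p⊆U i)
    where
    pointwise : ∀ {t u b} → t ≡ true → (b ≡ true → u ≡ true) → 𝟙 (t ∧ b) ≡ 𝟙 (u ∧ b)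
    pointwise {u = u} {false} refl _ = cong 𝟙 (sym (∧-zeroʳ u))
    pointwise {b = true} refl b⇒u rewrite b⇒u refl = refl

  #pos #neg #nul #nonpos : Subset n → (Fin n → Sign) → ℕ
  #pos U σ = count U (isPos ∘ σ)
  #nonpos U σ = count U (not ∘ isPos ∘ σ)
  #neg U σ = count U (isNeg ∘ σ)
  #nul U σ = count U (isNul ∘ σ)

  newlyPos newlyNeg : Subset n → (Fin n → Sign) → (Fin n → Sign) → ℕ
  newlyPos U σ τ = count U (λ i → isNul (σ i) ∧ isPos (τ i))
  newlyNeg U σ τ = count U (λ i → isNul (σ i) ∧ isNeg (τ i))

  #pos+#neg+#nul : ∀ U σ → #pos U σ ℕ.+ #neg U σ ℕ.+ #nul U σ ≡ size U
  #pos+#neg+#nul U σ =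
    trans (cong (ℕ._+ #nul U σ) (count-+ U (pos+neg ∘ σ))) (count-+ U (nonnul+nul ∘ σ))
    where
    pos+neg : ∀ s → 𝟙 (isPos s) ℕ.+ 𝟙 (isNeg s) ≡ 𝟙 (not (isNul s))
    pos+neg pos = refl
    pos+neg nul = refl
    pos+neg neg = refl
    nonnul+nul : ∀ s → 𝟙 (not (isNul s)) ℕ.+ 𝟙 (isNul s) ≡ 𝟙 true
    nonnul+nul pos = refl
    nonnul+nul nul = refl
    nonnul+nul neg = refl

  #nonpos+#pos : ∀ U σ → #nonpos U σ ℕ.+ #pos U σ ≡ size U
  #nonpos+#pos U σ = count-+ U (nonpos+pos ∘ σ)
    where
    nonpos+pos : ∀ s → 𝟙 (not (isPos s)) ℕ.+ 𝟙 (isPos s) ≡ 𝟙 true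
    nonpos+pos pos = refl
    nonpos+pos nul = refl
    nonpos+pos neg = refl

  #pos-perturb : ∀ U σ τ → #pos U (λ i → perturb (σ i) (τ i)) ≡ #pos U σ ℕ.+ newlyPos U σ τ
  #pos-perturb U σ τ = sym (count-+ U λ i → pointwise (σ i) (τ i))
    where
    pointwise : ∀ s t → 𝟙 (isPos s) ℕ.+ 𝟙 (isNul s ∧ isPos t) ≡ 𝟙 (isPos (perturb s t))
    pointwise pos _ = refl
    pointwise neg _ = refl
    pointwise nul pos = refl
    pointwise nul nul = refl
    pointwise nul neg = refl

  #neg-perturb : ∀ U σ τ → #neg U (λ i → perturb (σ i) (τ i)) ≡ #neg U σ ℕ.+ newlyNeg U σ τ
  #neg-perturb U σ τ = sym (count-+ U λ i → pointwise (σ i) (τ i))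
    where
    pointwise : ∀ s t → 𝟙 (isNeg s) ℕ.+ 𝟙 (isNul s ∧ isNeg t) ≡ 𝟙 (isNeg (perturb s t))
    pointwise pos _ = refl
    pointwise neg _ = refl
    pointwise nul pos = refl
    pointwise nul nul = refl
    pointwise nul neg = refl

  #nul-perturb< : ∀ U (σ τ : Fin n → Sign) i → lookup U i ≡ true → σ i ≡ nul → τ i ≢ nul →
                  #nul U (λ i → perturb (σ i) (τ i)) ℕ.< #nul U σ
  #nul-perturb< U σ τ i i∈U σi≡nul τi≢nul =
    sum-mono-< (λ j → pointwise≤ (lookup U j) (σ j) (τ j)) i
               (pointwise< (lookup U i) (σ i) (τ i) i∈U σi≡nul τi≢nul)
    where
    pointwise≤ : ∀ u s t → 𝟙 (u ∧ isNul (perturb s t)) ℕ.≤ 𝟙 (u ∧ isNul s)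
    pointwise≤ false _ _ = z≤n
    pointwise≤ true pos _ = z≤n
    pointwise≤ true neg _ = z≤n
    pointwise≤ true nul pos = z≤n
    pointwise≤ true nul nul = s≤s z≤n
    pointwise≤ true nul neg = z≤n
    pointwise< : ∀ u s t → u ≡ true → s ≡ nul → t ≢ nul → 𝟙 (u ∧ isNul (perturb s t)) ℕ.< 𝟙 (u ∧ isNul s)
    pointwise< true nul pos refl refl _ = s≤s z≤n
    pointwise< true nul neg refl refl _ = s≤s z≤n
    pointwise< true nul nul refl refl t≢nul = ⊥-elim (t≢nul refl)

  newlyPos-opposite : ∀ U σ τ → newlyPos U σ (opposite ∘ τ) ≡ newlyNeg U σ τ
  newlyPos-opposite U σ τ = count-cong U λ i _ → cong (isNul (σ i) ∧_) (pointwise (τ i))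
    where
    pointwise : ∀ t → isPos (opposite t) ≡ isNeg t
    pointwise pos = refl
    pointwise nul = refl
    pointwise neg = refl

  newlyNeg-opposite : ∀ U σ τ → newlyNeg U σ (opposite ∘ τ) ≡ newlyPos U σ τ
  newlyNeg-opposite U σ τ = count-cong U λ i _ → cong (isNul (σ i) ∧_) (pointwise (τ i))
    where
    pointwise : ∀ t → isNeg (opposite t) ≡ isPos t
    pointwise pos = refl
    pointwise nul = refl
    pointwise neg = refl

  size-⊤ : ∀ W → size ⊤ ≡ size W ℕ.+ size (∁ W)
  size-⊤ W = trans (sum-cong-≗ λ i → pointwise (lookup-replicate i true) (lookup-map i not W))
                   (∑-distrib-+ (λ i → 𝟙 (lookup W i ∧ true)) (λ i → 𝟙 (lookup (∁ W) i ∧ true)))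
    where
    pointwise : ∀ {t u c} → t ≡ true → c ≡ not u → 𝟙 (t ∧ true) ≡ 𝟙 (u ∧ true) ℕ.+ 𝟙 (c ∧ true)
    pointwise {u = false} refl refl = refl
    pointwise {u = true} refl refl = refl

module Signs (ℝ : RealField) where
  open OrderedFieldProperties ℝ
  open SmallPerturbations ℝ using (KeepsSign)

  sign : Carrier → Sign
  sign x with compare 0# x
  ... | tri< _ _ _ = pos
  ... | tri≈ _ _ _ = nul
  ... | tri> _ _ _ = neg

  sign-pos : ∀ {x} → 0# < x → sign x ≡ pos
  sign-pos {x} 0<x with compare 0# x
  ... | tri< _ _ _ = refl
  ... | tri≈ _ 0≡x _ = ⊥-elim (<-irrefl 0≡x 0<x)
  ... | tri> _ _ x<0 = ⊥-elim (<-asym 0<x x<0)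

  sign-nul : ∀ {x} → x ≡ 0# → sign x ≡ nul
  sign-nul {x} x≡0 with compare 0# x
  ... | tri< _ 0≢x _ = ⊥-elim (0≢x (sym x≡0))
  ... | tri≈ _ _ _ = refl
  ... | tri> _ 0≢x _ = ⊥-elim (0≢x (sym x≡0))

  sign-neg : ∀ {x} → x < 0# → sign x ≡ neg
  sign-neg {x} x<0 with compare 0# x
  ... | tri< 0<x _ _ = ⊥-elim (<-asym 0<x x<0)
  ... | tri≈ _ 0≡x _ = ⊥-elim (<-irrefl (sym 0≡x) x<0)
  ... | tri> _ _ _ = refl

  sign≡nul⇒≡0 : ∀ {x} → sign x ≡ nul → x ≡ 0#
  sign≡nul⇒≡0 {x} sx≡nul with compare 0# x
  ... | tri≈ _ 0≡x _ = sym 0≡x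

  sign≢nul : ∀ {x} → x ≢ 0# → isNul (sign x) ≡ false
  sign≢nul {x} x≢0 with compare 0# x
  ... | tri< _ _ _ = refl
  ... | tri≈ _ 0≡x _ = ⊥-elim (x≢0 (sym 0≡x))
  ... | tri> _ _ _ = refl

  posB≡isPos∘sign : ∀ x → posB ℝ x ≡ isPos (sign x)
  posB≡isPos∘sign x with compare 0# x
  ... | tri< _ _ _ = refl
  ... | tri≈ _ _ _ = refl
  ... | tri> _ _ _ = refl

  negB≡isNeg∘sign : ∀ x → negB ℝ x ≡ isNeg (sign x)
  negB≡isNeg∘sign x with compare x 0#
  ... | tri< x<0 _ _ = sym (cong isNeg (sign-neg x<0))
  ... | tri≈ _ x≡0 _ = sym (cong isNeg (sign-nul x≡0))
  ... | tri> _ _ 0<x = sym (cong isNeg (sign-pos 0<x))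

  sign-*pos : ∀ {ε} y → 0# < ε → sign (ε * y) ≡ sign y
  sign-*pos {ε} y 0<ε with compare 0# y
  ... | tri< 0<y _ _ = sign-pos (*-pos 0<ε 0<y)
  ... | tri≈ _ 0≡y _ = sign-nul (trans (cong (ε *_) (sym 0≡y)) (zeroʳ ε))
  ... | tri> _ _ y<0 = sign-neg (*-pos-neg 0<ε y<0)

  sign-perturb : ∀ {x y ε} → 0# < ε → KeepsSign x y ε → sign (x + ε * y) ≡ perturb (sign x) (sign y)
  sign-perturb {x} {y} {ε} 0<ε (keepPos , keepNeg) with compare 0# x
  ... | tri< 0<x _ _ = sign-pos (keepPos 0<x)
  ... | tri≈ _ 0≡x _ = trans (cong (λ z → sign (z + ε * y)) (sym 0≡x))
                             (trans (cong sign (+-identityˡ (ε * y))) (sign-*pos y 0<ε))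
  ... | tri> _ _ x<0 = sign-neg (keepNeg x<0)

  sign-opposite : ∀ y → sign ((- 1#) * y) ≡ opposite (sign y)
  sign-opposite y with compare 0# y
  ... | tri< 0<y _ _ = sign-neg (subst (_< 0#) (sym (-1*x≡-x y)) (0<x⇒-x<0 0<y))
  ... | tri≈ _ 0≡y _ = sign-nul (trans (-1*x≡-x y) (trans (cong -_ (sym 0≡y)) -0≡0))
  ... | tri> _ _ y<0 = sign-pos (subst (0# <_) (sym (-1*x≡-x y)) (x<0⇒0<-x y<0))

record Enumeration {n : ℕ} (S : Subset n) : Set where
  field
    {card}   : ℕ
    elems    : Vec (Fin n) card
    sound    : ∀ j → lookup elems j ∈ S
    complete : ∀ {i} → i ∈ S → ∃ λ j → lookup elems j ≡ i

enumerate : ∀ {n} (S : Subset n) → Enumeration S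
enumerate [] = record { elems = [] ; sound = λ () ; complete = λ () }
enumerate (b ∷ S) with enumerate S
... | record { elems = es ; sound = sound ; complete = complete } with b
...   | true = record { elems = zero ∷ map suc es ; sound = sound′ ; complete = complete′ }
  where
  sound′ : ∀ j → lookup (zero ∷ map suc es) j ∈ (true ∷ S)
  sound′ zero = here
  sound′ (suc j) = subst (_∈ (true ∷ S)) (sym (lookup-map j suc es)) (there (sound j))
  complete′ : ∀ {i} → i ∈ (true ∷ S) → ∃ λ j → lookup (zero ∷ map suc es) j ≡ i
  complete′ here = zero , refl
  complete′ (there i∈S) = let (j , esj≡i) = complete i∈S in suc j , trans (lookup-map j suc es) (cong suc esj≡i)
...   | false = record { elems = map suc es ; sound = sound′ ; complete = complete′ }
  where
  sound′ : ∀ j → lookup (map suc es) j ∈ (false ∷ S)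
  sound′ j = subst (_∈ (false ∷ S)) (sym (lookup-map j suc es)) (there (sound j))
  complete′ : ∀ {i} → i ∈ (false ∷ S) → ∃ λ j → lookup (map suc es) j ≡ i
  complete′ (there i∈S) = let (j , esj≡i) = complete i∈S in j , trans (lookup-map j suc es) (cong suc esj≡i)

module IntegerArithmetic where
  open import Data.Integer using (+_; _+_; _-_; _≤_)
  open import Data.Integer.Tactic.RingSolver using (solve-∀)

  p-m≤[p+a]-[m+b] : ∀ p m a b → b ℕ.≤ a → + p - + m ≤ + (p ℕ.+ a) - + (m ℕ.+ b)
  p-m≤[p+a]-[m+b] p m a b b≤a = begin
    + p - + m                        ≡⟨ sym (ℤP.+-identityʳ _) ⟩
    (+ p - + m) + + 0                ≤⟨ ℤP.+-monoʳ-≤ (+ p - + m) (ℤP.i≤j⇒0≤j-i (ℤ.+≤+ b≤a)) ⟩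
    (+ p - + m) + (+ a - + b)        ≡⟨ regroup (+ p) (+ m) (+ a) (+ b) ⟩
    (+ p + + a) - (+ m + + b)        ≡⟨ sym (cong₂ _-_ (ℤP.pos-+ p a) (ℤP.pos-+ m b)) ⟩
    + (p ℕ.+ a) - + (m ℕ.+ b)        ∎
    where
    open ℤP.≤-Reasoning
    regroup : ∀ p m a b → (p - m) + (a - b) ≡ (p + a) - (m + b)
    regroup = solve-∀

  disc+size : ∀ p m z → (+ p - + m) + + (p ℕ.+ m ℕ.+ z) ≡ + p + + p + + z
  disc+size p m z = begin
    (+ p - + m) + + (p ℕ.+ m ℕ.+ z)    ≡⟨ cong (λ x → (+ p - + m) + x)
                                               (trans (ℤP.pos-+ (p ℕ.+ m) z) (cong (_+ + z) (ℤP.pos-+ p m))) ⟩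
    (+ p - + m) + (+ p + + m + + z)    ≡⟨ regroup (+ p) (+ m) (+ z) ⟩
    + p + + p + + z                    ∎
    where
    open ≡-Reasoning
    regroup : ∀ p m z → (p - m) + (p + m + z) ≡ p + p + z
    regroup = solve-∀

module GenericFunctionals (ℝ : RealField) {r n : ℕ} (V : Fin n → Vec (RealField.Carrier ℝ) r) where
  open Configuration ℝ V
  open SmallPerturbations ℝ using (forSmall-keepsSign-all)
  open Signs ℝ
  open Counting {n}
  open IntegerArithmetic

  signs : Vec Carrier r → Fin n → Sign
  signs f i = sign (f · V i)

  isMaxℤ-cong : ∀ {A} {s t : Vec Carrier r → ℤ} {m} → (∀ f → s f ≡ t f) → IsMaxℤ ℝ V A s m → IsMaxℤ ℝ V A t m
  isMaxℤ-cong {m = m} s≡t ((f , af , sf≡m) , s≤m) =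
    (f , af , trans (sym (s≡t f)) sf≡m) , λ g ag → subst (ℤ._≤ m) (s≡t g) (s≤m g ag)

  isMinℕ-cong : ∀ {A} {s t : Vec Carrier r → ℕ} {m} → (∀ f → s f ≡ t f) → IsMinℕ ℝ V A s m → IsMinℕ ℝ V A t m
  isMinℕ-cong {m = m} s≡t ((f , af , sf≡m) , m≤s) =
    (f , af , trans (sym (s≡t f)) sf≡m) , λ g ag → subst (m ℕ.≤_) (s≡t g) (m≤s g ag)

  min+max≡total : ∀ {A} {s t : Vec Carrier r → ℕ} {N c m} → (∀ f → A f → t f ℕ.+ s f ≡ N) →
                  IsMinℕ ℝ V A t c → IsMaxℤ ℝ V A (λ f → ℤ.+ s f) m → ℤ.+ c ℤ.+ m ≡ ℤ.+ N
  min+max≡total {s = s} {t} {N} {c} s+t≡N ((f , af , refl) , c≤t) ((g , ag , refl) , s≤m) =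
    trans (sym (ℤP.pos-+ (t f) (s g))) (cong ℤ.+_ (ℕP.≤-antisym ≤N N≤))
    where
    ≤N : t f ℕ.+ s g ℕ.≤ N
    ≤N = subst (t f ℕ.+ s g ℕ.≤_) (s+t≡N g ag) (ℕP.+-monoˡ-≤ (s g) (c≤t g ag))
    N≤ : N ℕ.≤ t f ℕ.+ s g
    N≤ = subst (ℕ._≤ t f ℕ.+ s g) (s+t≡N f af) (ℕP.+-monoʳ-≤ (t f) (ℤP.drop‿+≤+ (s≤m f af)))

  countBy≡count : ∀ b f U → countBy ℝ V b f U ≡ count U (λ i → b (f · V i))
  countBy≡count b f U = trans (cong ListAction.sum (map-tabulate id h)) (listSum-tabulate h)
    where
    h = λ i → 𝟙 (lookup U i ∧ b (f · V i))
    listSum-tabulate : ∀ {m} (h : Fin m → ℕ) → ListAction.sum (List.tabulate h) ≡ sum h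
    listSum-tabulate {zero} h = refl
    listSum-tabulate {suc m} h = cong (h zero ℕ.+_) (listSum-tabulate (h ∘ suc))

  plusCount≡#pos : ∀ f U → plusCount ℝ V f U ≡ #pos U (signs f)
  plusCount≡#pos f U = trans (countBy≡count (posB ℝ) f U) (count-cong U λ i _ → posB≡isPos∘sign (f · V i))

  minusCount≡#neg : ∀ f U → minusCount ℝ V f U ≡ #neg U (signs f)
  minusCount≡#neg f U = trans (countBy≡count (negB ℝ) f U) (count-cong U λ i _ → negB≡isNeg∘sign (f · V i))

  closedMinusCount≡#nonpos : ∀ f U → closedMinusCount ℝ V f U ≡ #nonpos U (signs f)
  closedMinusCount≡#nonpos f U =
    trans (countBy≡count (λ x → not (posB ℝ x)) f U) (count-cong U λ i _ → cong not (posB≡isPos∘sign (f · V i)))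

  perturbation : ∀ f g → Σ Carrier λ ε → 0# < ε × ∀ i → signs (f ⊞ ε ⊙ g) i ≡ perturb (signs f i) (signs g i)
  perturbation f g with forSmall-keepsSign-all (λ i → f · V i) (λ i → g · V i)
  ... | ε , 0<ε , keeps = ε , 0<ε , λ i →
    trans (cong sign (⊞⊙-· f ε g (V i))) (sign-perturb 0<ε (keeps ε 0<ε (inj₂ refl) i))

  module Relative {S : Subset n} (E : Enumeration S) where
    open Enumeration E

    Admissible : Vec Carrier r → Set
    Admissible = QuotF ℝ V S

    Y : Vec (Vec Carrier r) card
    Y = map V elems

    inLinSpan⇒inSpan : ∀ {v} → InLinSpan Y v → InSpan ℝ V S v
    inLinSpan⇒inSpan (c , v≡Yc) = card , elems , sound , c , trans v≡Yc (sym (lincomb≡linComb elems c))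

    admissible-inLinSpan : ∀ {f v} → Admissible f → InLinSpan Y v → f · v ≡ 0#
    admissible-inLinSpan {f} (_ , fS≡0) v∈Y = annihilatesSet-inSpan f fS≡0 (inLinSpan⇒inSpan v∈Y)

    annihilates⇒annihilatesSet : ∀ g → Annihilates g Y → AnnihilatesSet g S
    annihilates⇒annihilatesSet g gY≡0 i i∈S with complete i∈S
    ... | j , elemsj≡i = trans (cong (λ k → g · V k) (sym elemsj≡i))
                               (trans (cong (g ·_) (sym (lookup-map j V elems))) (gY≡0 j))

    separated? : ∀ v → Dec (Separated Y v)
    separated? v with spanOrSeparated Y v
    ... | inj₁ v∈Y = no (inLinSpan⇒¬separated Y v v∈Y)
    ... | inj₂ v∉Y = yes v∉Y

    inLinSpan? : ∀ v → Dec (InLinSpan Y v)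
    inLinSpan? v with spanOrSeparated Y v
    ... | inj₁ v∈Y = yes v∈Y
    ... | inj₂ v∉Y = no λ v∈Y → inLinSpan⇒¬separated Y v v∈Y v∉Y

    forced : Fin n → Bool
    forced i = does (inLinSpan? (V i))

    forced⇒inSpan : ∀ i → forced i ≡ true → InSpan ℝ V S (V i)
    forced⇒inSpan i forced≡true with inLinSpan? (V i)
    ... | yes Vi∈Y = inLinSpan⇒inSpan Vi∈Y

    module _ (U : Subset n) where

      Generic : Vec Carrier r → Set
      Generic f = ∀ i → lookup U i ≡ true → f · V i ≡ 0# → InLinSpan Y (V i)

      plus minus zeros : Vec Carrier r → ℕ
      plus f = #pos U (signs f)
      minus f = #neg U (signs f)
      zeros f = #nul U (signs f)

      disc : Vec Carrier r → ℤ
      disc f = ℤ.+ plus f ℤ.- ℤ.+ minus f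

      generic-zeros : ∀ {f} → Admissible f → Generic f → zeros f ≡ count U forced
      generic-zeros {f} adm generic = count-cong U pointwise
        where
        pointwise : ∀ i → lookup U i ≡ true → isNul (signs f i) ≡ forced i
        pointwise i i∈U with inLinSpan? (V i)
        ... | yes Vi∈Y = cong isNul (sign-nul (admissible-inLinSpan adm Vi∈Y))
        ... | no Vi∉Y = sign≢nul λ fVi≡0 → Vi∉Y (generic i i∈U fVi≡0)

      Improvement : Vec Carrier r → Vec Carrier r → Set
      Improvement f f' = Admissible f' × plus f ℕ.≤ plus f' × disc f ℤ.≤ disc f'

      -- Tilting f by a small multiple of g keeps every nonzero sign of f and gives each zero of f
      -- the sign of g.
      tilt : ∀ {f i} g → Admissible f → lookup U i ≡ true → f · V i ≡ 0# →
             AnnihilatesSet g S → signs g i ≢ nul →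
             newlyNeg U (signs f) (signs g) ℕ.≤ newlyPos U (signs f) (signs g) →
             Σ (Vec Carrier r) λ f' → Improvement f f' × zeros f' ℕ.< zeros f
      tilt {f} {i} g (_ , fS≡0) i∈U fVi≡0 gS≡0 gi≢nul neg≤pos with perturbation f g
      ... | ε , _ , signs≡ = f' , ((f'≢𝟘 , f'S≡0) , plus≤ , disc≤) , zeros<
        where
        f' = f ⊞ ε ⊙ g
        σ = signs f
        τ = signs g
        fi≡nul : σ i ≡ nul
        fi≡nul = sign-nul fVi≡0
        f'≢𝟘 : f' ≢ 𝟘
        f'≢𝟘 f'≡𝟘 = gi≢nul (begin
          τ i               ≡⟨ cong (λ s → perturb s (τ i)) (sym fi≡nul) ⟩
          perturb (σ i) (τ i) ≡⟨ sym (signs≡ i) ⟩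
          signs f' i        ≡⟨ sign-nul (trans (cong (_· V i) f'≡𝟘) (·-𝟘ˡ (V i))) ⟩
          nul               ∎)
          where open ≡-Reasoning
        f'S≡0 : AnnihilatesSet f' S
        f'S≡0 j j∈S = trans (⊞⊙-· f ε g (V j))
          (trans (cong₂ (λ a b → a + ε * b) (fS≡0 j j∈S) (gS≡0 j j∈S)) (trans (+-identityˡ _) (zeroʳ ε)))
        plus≡ : plus f' ≡ plus f ℕ.+ newlyPos U σ τ
        plus≡ = trans (count-cong U λ j _ → cong isPos (signs≡ j)) (#pos-perturb U σ τ)
        minus≡ : minus f' ≡ minus f ℕ.+ newlyNeg U σ τ
        minus≡ = trans (count-cong U λ j _ → cong isNeg (signs≡ j)) (#neg-perturb U σ τ)
        plus≤ : plus f ℕ.≤ plus f'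
        plus≤ = subst (plus f ℕ.≤_) (sym plus≡) (ℕP.m≤m+n _ _)
        disc≤ : disc f ℤ.≤ disc f'
        disc≤ = subst₂ (λ p m → disc f ℤ.≤ ℤ.+ p ℤ.- ℤ.+ m) (sym plus≡) (sym minus≡)
                       (p-m≤[p+a]-[m+b] (plus f) (minus f) _ _ neg≤pos)
        zeros< : zeros f' ℕ.< zeros f
        zeros< = subst (ℕ._< zeros f) (sym (count-cong U λ j _ → cong isNul (signs≡ j)))
                       (#nul-perturb< U σ τ i i∈U fi≡nul gi≢nul)

      improve : ∀ {f i} → Admissible f → lookup U i ≡ true → f · V i ≡ 0# → Separated Y (V i) →
                Σ (Vec Carrier r) λ f' → Improvement f f' × zeros f' ℕ.< zeros f
      improve {f} {i} adm i∈U fVi≡0 (g , gY≡0 , gVi≢0)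
        with newlyNeg U (signs f) (signs g) ℕP.≤? newlyPos U (signs f) (signs g)
      ... | yes neg≤pos = tilt g adm i∈U fVi≡0 gS≡0 (gVi≢0 ∘ sign≡nul⇒≡0) neg≤pos
        where gS≡0 = annihilates⇒annihilatesSet g gY≡0
      ... | no neg≰pos = tilt -g adm i∈U fVi≡0 -gS≡0 -gi≢nul neg≤pos
        where
        -g = (- 1#) ⊙ g
        signs-g : ∀ j → signs -g j ≡ opposite (signs g j)
        signs-g j = trans (cong sign (·-⊙ˡ (- 1#) g (V j))) (sign-opposite (g · V j))
        -gS≡0 : AnnihilatesSet -g S
        -gS≡0 j j∈S = trans (·-⊙ˡ (- 1#) g (V j))
          (trans (cong ((- 1#) *_) (annihilates⇒annihilatesSet g gY≡0 j j∈S)) (zeroʳ _))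
        -gi≢nul : signs -g i ≢ nul
        -gi≢nul -gi≡nul = gVi≢0 (sign≡nul⇒≡0 (opposite≡nul (trans (sym (signs-g i)) -gi≡nul)))
          where
          opposite≡nul : ∀ {t} → opposite t ≡ nul → t ≡ nul
          opposite≡nul {nul} _ = refl
        neg≤pos : newlyNeg U (signs f) (signs -g) ℕ.≤ newlyPos U (signs f) (signs -g)
        neg≤pos = subst₂ ℕ._≤_
          (sym (trans (count-cong U λ j _ → cong (λ t → isNul (signs f j) ∧ isNeg t) (signs-g j))
                      (newlyNeg-opposite U (signs f) (signs g))))
          (sym (trans (count-cong U λ j _ → cong (λ t → isNul (signs f j) ∧ isPos t) (signs-g j))
                      (newlyPos-opposite U (signs f) (signs g))))
          (ℕP.<⇒≤ (ℕP.≰⇒> neg≰pos))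

      -- Induction on the number of zeros of f on U, which every improvement step decreases.
      genericImprovement : ∀ f → Admissible f → Σ (Vec Carrier r) λ f' → Improvement f f' × Generic f'
      genericImprovement f adm = go (suc (zeros f)) f adm ℕP.≤-refl
        where
        go : ∀ bound f → Admissible f → zeros f ℕ.< bound → Σ (Vec Carrier r) λ f' → Improvement f f' × Generic f'
        go (suc bound) f adm zeros<bound
          with any? (λ i → (lookup U i BoolP.≟ true) ×-dec (f · V i ≟ 0#) ×-dec separated? (V i))
        ... | no ¬separable = f , (adm , ℕP.≤-refl , ℤP.≤-refl) , generic
          where
          generic : Generic f
          generic i i∈U fVi≡0 with spanOrSeparated Y (V i)
          ... | inj₁ Vi∈Y = Vi∈Y
          ... | inj₂ Vi∉Y = ⊥-elim (¬separable (i , i∈U , fVi≡0 , Vi∉Y))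
        ... | yes (i , i∈U , fVi≡0 , Vi∉Y) with improve adm i∈U fVi≡0 Vi∉Y
        ...   | f₁ , (adm₁ , plus≤₁ , disc≤₁) , zeros<
          with go bound f₁ adm₁ (ℕP.<-≤-trans zeros< (ℕP.≤-pred zeros<bound))
        ...     | f₂ , (adm₂ , plus≤₂ , disc≤₂) , generic₂ =
          f₂ , (adm₂ , ℕP.≤-trans plus≤₁ plus≤₂ , ℤP.≤-trans disc≤₁ disc≤₂) , generic₂

      generic-disc : ∀ {f} → Admissible f → Generic f →
                     disc f ℤ.+ ℤ.+ size U ≡ ℤ.+ plus f ℤ.+ ℤ.+ plus f ℤ.+ ℤ.+ count U forced
      generic-disc {f} adm generic = begin
        disc f ℤ.+ ℤ.+ size U                                  ≡⟨ cong (λ N → disc f ℤ.+ ℤ.+ N) (sym size≡) ⟩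
        disc f ℤ.+ ℤ.+ (plus f ℕ.+ minus f ℕ.+ count U forced) ≡⟨ disc+size (plus f) (minus f) _ ⟩
        ℤ.+ plus f ℤ.+ ℤ.+ plus f ℤ.+ ℤ.+ count U forced       ∎
        where
        open ≡-Reasoning
        size≡ : plus f ℕ.+ minus f ℕ.+ count U forced ≡ size U
        size≡ = trans (cong (plus f ℕ.+ minus f ℕ.+_) (sym (generic-zeros adm generic)))
                      (#pos+#neg+#nul U (signs f))

      MaxPlus : ℤ → Set
      MaxPlus = IsMaxℤ ℝ V Admissible (λ f → ℤ.+ plusCount ℝ V f U)

      disc-formula : ∀ {mP D} → MaxPlus mP → DiscG ℝ V Admissible U D →
                     D ℤ.+ ℤ.+ size U ≡ mP ℤ.+ mP ℤ.+ ℤ.+ count U forced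
      disc-formula maxPlus maxDisc
        with isMaxℤ-cong (λ f → cong ℤ.+_ (plusCount≡#pos f U)) maxPlus
           | isMaxℤ-cong (λ f → cong₂ (λ p m → ℤ.+ p ℤ.- ℤ.+ m) (plusCount≡#pos f U) (minusCount≡#neg f U)) maxDisc
      ... | (fP , admP , refl) , plus≤ | (fD , admD , refl) , disc≤
        with genericImprovement fP admP | genericImprovement fD admD
      ... | f₁ , (adm₁ , plusfP≤ , _) , generic₁ | f₂ , (adm₂ , _ , discfD≤) , generic₂ =
        ℤP.≤-antisym upper lower
        where
        open ℤP.≤-Reasoning
        N = ℤ.+ size U
        Z = ℤ.+ count U forced
        plusf₁≡plusfP : plus f₁ ≡ plus fP
        plusf₁≡plusfP = ℕP.≤-antisym (ℤP.drop‿+≤+ (plus≤ f₁ adm₁)) plusfP≤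
        lower : ℤ.+ plus fP ℤ.+ ℤ.+ plus fP ℤ.+ Z ℤ.≤ disc fD ℤ.+ N
        lower = begin
          ℤ.+ plus fP ℤ.+ ℤ.+ plus fP ℤ.+ Z ≡⟨ cong (λ p → ℤ.+ p ℤ.+ ℤ.+ p ℤ.+ Z) (sym plusf₁≡plusfP) ⟩
          ℤ.+ plus f₁ ℤ.+ ℤ.+ plus f₁ ℤ.+ Z ≡⟨ sym (generic-disc adm₁ generic₁) ⟩
          disc f₁ ℤ.+ N                     ≤⟨ ℤP.+-monoˡ-≤ N (disc≤ f₁ adm₁) ⟩
          disc fD ℤ.+ N                     ∎
        upper : disc fD ℤ.+ N ℤ.≤ ℤ.+ plus fP ℤ.+ ℤ.+ plus fP ℤ.+ Z
        upper = begin
          disc fD ℤ.+ N                     ≤⟨ ℤP.+-monoˡ-≤ N discfD≤ ⟩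
          disc f₂ ℤ.+ N                     ≡⟨ generic-disc adm₂ generic₂ ⟩
          ℤ.+ plus f₂ ℤ.+ ℤ.+ plus f₂ ℤ.+ Z ≤⟨ ℤP.+-monoˡ-≤ Z (ℤP.+-mono-≤ (plus≤ f₂ adm₂) (plus≤ f₂ adm₂)) ⟩
          ℤ.+ plus fP ℤ.+ ℤ.+ plus fP ℤ.+ Z ∎

      codeg-formula : ∀ {mP c} → MaxPlus mP → CodegG ℝ V Admissible U c → ℤ.+ c ℤ.+ mP ≡ ℤ.+ size U
      codeg-formula maxPlus minNonpos =
        min+max≡total (λ f _ → #nonpos+#pos U (signs f))
          (isMinℕ-cong (λ f → closedMinusCount≡#nonpos f U) minNonpos)
          (isMaxℤ-cong (λ f → cong ℤ.+_ (plusCount≡#pos f U)) maxPlus)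

module DefectArithmetic where
  open import Data.Integer using (+_; -[1+_]; _+_; _-_)
  open import Data.Integer.Tactic.RingSolver using (solve-∀)
  open import Function.Properties.Equivalence using () renaming (trans to ⇔-trans; sym to ⇔-sym)

  disc-defect : ∀ dV dW dQ mV mW mQ Z NW NQ → dV + (NW + NQ) ≡ mV + mV + Z → dW + NW ≡ mW + mW + Z →
                dQ + NQ ≡ mQ + mQ + + 0 → dV ≡ dW + dQ + ((mV - (mW + mQ)) + (mV - (mW + mQ)))
  disc-defect dV dW dQ mV mW mQ Z NW NQ eqV eqW eqQ = begin
    dV                                                  ≡⟨ move dV (NW + NQ) ⟩
    dV + (NW + NQ) - (NW + NQ)                          ≡⟨ cong (_- (NW + NQ)) eqV ⟩
    mV + mV + Z - (NW + NQ)                             ≡⟨ regroup mV mW mQ Z NW NQ ⟩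
    (mW + mW + Z - NW) + (mQ + mQ + + 0 - NQ) + δδ      ≡⟨ cong₂ (λ w q → w + q + δδ)
                                                               (cong (_- NW) (sym eqW)) (cong (_- NQ) (sym eqQ)) ⟩
    (dW + NW - NW) + (dQ + NQ - NQ) + δδ                ≡⟨ cong₂ (λ w q → w + q + δδ)
                                                               (sym (move dW NW)) (sym (move dQ NQ)) ⟩
    dW + dQ + δδ                                        ∎
    where
    open ≡-Reasoning
    δδ = (mV - (mW + mQ)) + (mV - (mW + mQ))
    move : ∀ d N → d ≡ d + N - N
    move = solve-∀
    regroup : ∀ mV mW mQ Z NW NQ → mV + mV + Z - (NW + NQ) ≡
              (mW + mW + Z - NW) + (mQ + mQ + + 0 - NQ) + ((mV - (mW + mQ)) + (mV - (mW + mQ)))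
    regroup = solve-∀

  deg-defect : ∀ gV gW gQ mV mW mQ kV kW kQ → kV ≡ kW + kQ →
               gV ≡ mV - kV → gW ≡ mW - kW → gQ ≡ mQ - kQ → gV ≡ gW + gQ + (mV - (mW + mQ))
  deg-defect gV gW gQ mV mW mQ kV kW kQ refl refl refl refl = regroup mV mW mQ kW kQ
    where
    regroup : ∀ mV mW mQ kW kQ → mV - (kW + kQ) ≡ (mW - kW) + (mQ - kQ) + (mV - (mW + mQ))
    regroup = solve-∀

  codeg-defect : ∀ cV cW cQ mV mW mQ NW NQ → cV + mV ≡ NW + NQ → cW + mW ≡ NW → cQ + mQ ≡ NQ →
                 cW + cQ ≡ cV + (mV - (mW + mQ))
  codeg-defect cV cW cQ mV mW mQ NW NQ eqV refl refl = begin
    cW + cQ                           ≡⟨ regroup₁ cW cQ mW mQ ⟩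
    cW + mW + (cQ + mQ) - (mW + mQ)   ≡⟨ cong (_- (mW + mQ)) (sym eqV) ⟩
    cV + mV - (mW + mQ)               ≡⟨ regroup₂ cV mV (mW + mQ) ⟩
    cV + (mV - (mW + mQ))             ∎
    where
    open ≡-Reasoning
    regroup₁ : ∀ cW cQ mW mQ → cW + cQ ≡ cW + mW + (cQ + mQ) - (mW + mQ)
    regroup₁ = solve-∀
    regroup₂ : ∀ cV mV m → cV + mV - m ≡ cV + (mV - m)
    regroup₂ = solve-∀

  defect-vanishes : ∀ {a b d} → a ≡ b + d → (a ≡ b ⇔ d ≡ + 0)
  defect-vanishes {b = b} {d} refl = mk⇔
    (λ b+d≡b → trans (solve₁ b d) (trans (cong (_- b) b+d≡b) (ℤP.+-inverseʳ b)))
    (λ d≡0 → trans (cong (λ x → b + x) d≡0) (ℤP.+-identityʳ b))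
    where
    solve₁ : ∀ b d → d ≡ b + d - b
    solve₁ = solve-∀

  double≡0⇔≡0 : ∀ d → (d + d ≡ + 0 ⇔ d ≡ + 0)
  double≡0⇔≡0 d = mk⇔ (halve d) λ { refl → refl }
    where
    halve : ∀ d → d + d ≡ + 0 → d ≡ + 0
    halve (+ zero) _ = refl
    halve (+ suc n) ()
    halve -[1+ n ] ()

  defects⇒equivalences : ∀ (dV dW dQ gV gW gQ : ℤ) (cV cW cQ : ℕ) δ →
    dV ≡ dW + dQ + (δ + δ) → gV ≡ gW + gQ + δ → + cW + + cQ ≡ + cV + δ →
    ((dV ≡ dW + dQ) ⇔ (gV ≡ gW + gQ)) × ((gV ≡ gW + gQ) ⇔ (cV ≡ cW ℕ.+ cQ))
  defects⇒equivalences dV dW dQ gV gW gQ cV cW cQ δ discDefect degDefect codegDefect =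
    ⇔-trans disc⇔δ≡0 (⇔-sym deg⇔δ≡0) , ⇔-trans deg⇔δ≡0 (⇔-sym codeg⇔δ≡0)
    where
    disc⇔δ≡0 = ⇔-trans (defect-vanishes discDefect) (double≡0⇔≡0 δ)
    deg⇔δ≡0 = defect-vanishes degDefect
    codeg⇔δ≡0 : (cV ≡ cW ℕ.+ cQ) ⇔ δ ≡ + 0
    codeg⇔δ≡0 = ⇔-trans (mk⇔ (λ cV≡ → sym (cong (λ c → + c) cV≡)) (sym ∘ ℤP.+-injective))
                         (defect-vanishes (trans (ℤP.pos-+ cW cQ) codegDefect))

module Splitting (ℝ : RealField) {r n : ℕ} (V : Fin n → Vec (RealField.Carrier ℝ) r)
                 (W : Subset n) (linClosed : LinClosed ℝ V W) where
  open Configuration ℝ V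
  open GenericFunctionals ℝ V
  open Counting {n}
  module R∅ = Relative (enumerate ∅)
  module RW = Relative (enumerate W)

  forced∅⊆W : ∀ i → R∅.forced i ≡ true → lookup W i ≡ true
  forced∅⊆W i forced≡true =
    []=⇒lookup (linClosed i (inSpan-mono (⊥-elim ∘ ∉⊥) (R∅.forced⇒inSpan i forced≡true)))

  forcedW∩∁W≡∅ : ∀ i → lookup (∁ W) i ≡ true → RW.forced i ≡ false
  forcedW∩∁W≡∅ i i∈∁W with RW.forced i in forced≡
  ... | false = refl
  ... | true = ⊥-elim (x∈∁p⇒x∉p (lookup⇒[]= i (∁ W) i∈∁W) (linClosed i (RW.forced⇒inSpan i forced≡)))

  quot∅-isMax : ∀ {s m} → IsMaxℤ ℝ V (NonZeroF ℝ V) s m → IsMaxℤ ℝ V (QuotF ℝ V ∅) s m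
  quot∅-isMax ((f , f≢0 , sf≡m) , maximal) =
    (f , (f≢0 , λ _ → ⊥-elim ∘ ∉⊥) , sf≡m) , λ f adm → maximal f (proj₁ adm)

  quot∅-isMin : ∀ {s m} → IsMinℕ ℝ V (NonZeroF ℝ V) s m → IsMinℕ ℝ V (QuotF ℝ V ∅) s m
  quot∅-isMin ((f , f≢0 , sf≡m) , minimal) =
    (f , (f≢0 , λ _ → ⊥-elim ∘ ∉⊥) , sf≡m) , λ f adm → minimal f (proj₁ adm)

  MaxPlus : Subset n → ℤ → Set
  MaxPlus U = IsMaxℤ ℝ V (NonZeroF ℝ V) (λ f → ℤ.+ plusCount ℝ V f U)

  size-split : ℤ.+ size ⊤ ≡ ℤ.+ size W ℤ.+ ℤ.+ size (∁ W)
  size-split = trans (cong ℤ.+_ (size-⊤ W)) (ℤP.pos-+ (size W) (size (∁ W)))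

  disc-split : ∀ {dV dW dQ mV mW mQ} → IsDisc ℝ V ⊤ dV → IsDisc ℝ V W dW → IsDiscQuot ℝ V W dQ →
               MaxPlus ⊤ mV → MaxPlus W mW → RW.MaxPlus (∁ W) mQ →
               dV ≡ dW ℤ.+ dQ ℤ.+ ((mV ℤ.- (mW ℤ.+ mQ)) ℤ.+ (mV ℤ.- (mW ℤ.+ mQ)))
  disc-split {dV} {dW} {dQ} {mV} {mW} {mQ} discV discW discQ maxV maxW maxQ =
    DefectArithmetic.disc-defect dV dW dQ mV mW mQ _ _ _ eqV eqW eqQ
    where
    eqV : dV ℤ.+ (ℤ.+ size W ℤ.+ ℤ.+ size (∁ W)) ≡ mV ℤ.+ mV ℤ.+ ℤ.+ count W R∅.forced
    eqV = trans (cong (λ N → dV ℤ.+ N) (sym size-split))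
                (trans (R∅.disc-formula ⊤ (quot∅-isMax maxV) (quot∅-isMax discV))
                       (cong (λ z → mV ℤ.+ mV ℤ.+ ℤ.+ z) (count-⊆-⊤ W forced∅⊆W)))
    eqW = R∅.disc-formula W (quot∅-isMax maxW) (quot∅-isMax discW)
    eqQ = trans (RW.disc-formula (∁ W) maxQ discQ)
                (cong (λ z → mQ ℤ.+ mQ ℤ.+ ℤ.+ z) (count-≡0 (∁ W) forcedW∩∁W≡∅))

  deg-split : ∀ {gV gW gQ kV kW kQ} mV mW mQ →
              IsRankMod ℝ V ∅ ⊤ kV → IsRankMod ℝ V ∅ W kW → IsRankMod ℝ V W (∁ W) kQ →
              gV ≡ mV ℤ.- ℤ.+ kV → gW ≡ mW ℤ.- ℤ.+ kW → gQ ≡ mQ ℤ.- ℤ.+ kQ →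
              gV ≡ gW ℤ.+ gQ ℤ.+ (mV ℤ.- (mW ℤ.+ mQ))
  deg-split {gV} {gW} {gQ} {kV} {kW} {kQ} mV mW mQ rankV rankW rankQ =
    DefectArithmetic.deg-defect gV gW gQ mV mW mQ (ℤ.+ kV) (ℤ.+ kW) (ℤ.+ kQ)
      (trans (cong ℤ.+_ (rank-additive W rankV rankW rankQ)) (ℤP.pos-+ kW kQ))

  codeg-split : ∀ {cV cW cQ mV mW mQ} →
                IsCodegStar ℝ V ⊤ cV → IsCodegStar ℝ V W cW → IsCodegStarQuot ℝ V W cQ →
                MaxPlus ⊤ mV → MaxPlus W mW → RW.MaxPlus (∁ W) mQ →
                ℤ.+ cW ℤ.+ ℤ.+ cQ ≡ ℤ.+ cV ℤ.+ (mV ℤ.- (mW ℤ.+ mQ))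
  codeg-split {cV} {cW} {cQ} {mV} {mW} {mQ} codegV codegW codegQ maxV maxW maxQ =
    DefectArithmetic.codeg-defect (ℤ.+ cV) (ℤ.+ cW) (ℤ.+ cQ) mV mW mQ _ _
      (trans (R∅.codeg-formula ⊤ (quot∅-isMax maxV) (quot∅-isMin codegV)) size-split)
      (R∅.codeg-formula W (quot∅-isMax maxW) (quot∅-isMin codegW))
      (RW.codeg-formula (∁ W) maxQ codegQ)

mainTheorem12 : (ℝ : RealField) {r n : ℕ} (V : Fin n → Vec (RealField.Carrier ℝ) r)
    (W : Subset n) → LinClosed ℝ V W →
    (dV dW dQ gV gW gQ : ℤ) (cV cW cQ : ℕ) →
    IsDisc ℝ V ⊤ dV → IsDisc ℝ V W dW → IsDiscQuot ℝ V W dQ →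
    IsDegStar ℝ V ⊤ gV → IsDegStar ℝ V W gW → IsDegStarQuot ℝ V W gQ →
    IsCodegStar ℝ V ⊤ cV → IsCodegStar ℝ V W cW → IsCodegStarQuot ℝ V W cQ →
    ((dV ≡ dW ℤ.+ dQ) ⇔ (gV ≡ gW ℤ.+ gQ)) ×
    ((gV ≡ gW ℤ.+ gQ) ⇔ (cV ≡ cW ℕ.+ cQ))
mainTheorem12 ℝ V W linClosed dV dW dQ gV gW gQ cV cW cQ discV discW discQ
  (kV , mV , rankV , maxV , gV≡) (kW , mW , rankW , maxW , gW≡) (kQ , mQ , rankQ , maxQ , gQ≡)
  codegV codegW codegQ =
  DefectArithmetic.defects⇒equivalences dV dW dQ gV gW gQ cV cW cQ (mV ℤ.- (mW ℤ.+ mQ))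
    (disc-split discV discW discQ maxV maxW maxQ)
    (deg-split mV mW mQ rankV rankW rankQ gV≡ gW≡ gQ≡)
    (codeg-split codegV codegW codegQ maxV maxW maxQ)
  where open Splitting ℝ V W linClosed
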